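{- Let $0<a<b<c<n-1$, and in a convex $n$-gon with vertices $0,\dots,n-1$ in cyclic order let $V_R=\{0,\dots,a-1\}$, $V_B=\{a,\dots,b-1\}$, $V_L=\{b,\dots,c-1\}$, $V_T=\{c,\dots,n-1\}$, and suppose $|V_L|\ge 3$, $|V_R|\ge 3$, $|V_T|\ge 2$, $|V_B|\ge 2$. Let $B_Q$ be the set of all edges $(i,j)$ with $i\in V_R, j\in V_L$ together with all edges $(i,j)$ with $i\in V_T, j\in V_B$. Let $B_T$ be a saturated blocker for triangulations of the convex polygon with vertex set $V_T\cup\{0,c-1\}$, and $B_B$ a saturated blocker for triangulations of the convex polygon with vertex set $V_B\cup\{a-1,b\}$. Then $B_M=(B_Q\setminus\{(0,c-1),(a-1,b)\})\cup B_T\cup B_B$ is a saturated blocker for triangulations of the $n$-gon, of size $|V_T||V_B|+|V_L||V_R|+|B_T|+|B_B|-2$.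
   Context: A triangulation of a convex polygon is a maximal set of pairwise non-crossing diagonals (crossing = sharing an interior point). A blocker (for triangulations) of a convex polygon is a set of its diagonals sharing at least one diagonal with every triangulation; it is saturated if removing any one of its edges yields a set that is not a blocker. -}

module Defs where

open import Data.Nat using (ℕ; zero; suc; _+_; _*_; _∸_; _<_; _≤_; _<ᵇ_; _≡ᵇ_)
open import Data.Bool using (Bool; true; false; _∧_; _∨_; not; if_then_else_)
open import Data.List using (List; map; upTo)
open import Data.Nat.ListAction using (sum)
open import Data.Product using (Σ; _×_; ∃-syntax)
open import Data.Sum using (_⊎_)
open import Relation.Nullary using (¬_)
open import Relation.Binary.PropositionalEquality using (_≡_)

-- A convex polygon is given by its vertex set W ⊆ ℕ (a Boolean predicate),
-- the vertices being points on a fixed circle in the cyclic order inherited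
-- from the order of ℕ.
VertexSet : Set
VertexSet = ℕ → Bool

polygon : ℕ → VertexSet
polygon n x = x <ᵇ n

-- A set of (undirected) segments, encoded on ordered pairs (i , j) with i < j.
EdgeSet : Set
EdgeSet = ℕ → ℕ → Bool

_∈ₑ_ : ℕ × ℕ → EdgeSet → Set
_∈ₑ_ (i Data.Product., j) S = S i j ≡ true

-- (i , j) with i < j is a diagonal of the convex polygon W: both endpoints
-- are vertices and they are not adjacent in the cyclic order of W, i.e.
-- there is a vertex of W strictly on each side of the segment.
Diagonal : VertexSet → ℕ → ℕ → Set
Diagonal W i j =
  i < j × W i ≡ true × W j ≡ true
  × (∃[ k ] (i < k × k < j × W k ≡ true))
  × (∃[ k ] ((k < i ⊎ j < k) × W k ≡ true))

-- Two diagonals (i , j), (k , l) (i < j, k < l) of a convex polygon cross,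
-- i.e. share an interior point, iff their endpoints interleave.
Cross : ℕ → ℕ → ℕ → ℕ → Set
Cross i j k l = (i < k × k < j × j < l) ⊎ (k < i × i < l × l < j)

DiagonalSet : VertexSet → EdgeSet → Set
DiagonalSet W S = ∀ i j → S i j ≡ true → Diagonal W i j

NonCrossing : EdgeSet → Set
NonCrossing S = ∀ i j k l → S i j ≡ true → S k l ≡ true → ¬ Cross i j k l

_⊆ₑ_ : EdgeSet → EdgeSet → Set
S ⊆ₑ S' = ∀ i j → S i j ≡ true → S' i j ≡ true

Triangulation : VertexSet → EdgeSet → Set
Triangulation W T =
  DiagonalSet W T × NonCrossing T
  × (∀ T' → DiagonalSet W T' → NonCrossing T' → T ⊆ₑ T' → T' ⊆ₑ T)

Blocker : VertexSet → EdgeSet → Set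
Blocker W B =
  DiagonalSet W B
  × (∀ T → Triangulation W T → ∃[ i ] ∃[ j ] (B i j ≡ true × T i j ≡ true))

remove : EdgeSet → ℕ → ℕ → EdgeSet
remove B i j x y = B x y ∧ not ((x ≡ᵇ i) ∧ (y ≡ᵇ j))

SaturatedBlocker : VertexSet → EdgeSet → Set
SaturatedBlocker W B =
  Blocker W B × (∀ i j → B i j ≡ true → ¬ Blocker W (remove B i j))

-- Number of pairs (i , j) with i < j < n in S (the cardinality of a set of
-- segments whose vertices lie in {0,…,n-1}).
size : ℕ → EdgeSet → ℕ
size n S = sum (map (λ j → sum (map (λ i → if S i j then 1 else 0) (upTo j))) (upTo n))

W-T : ℕ → ℕ → VertexSet
W-T n c x = (not (x <ᵇ c) ∧ (x <ᵇ n)) ∨ (x ≡ᵇ 0) ∨ (x ≡ᵇ (c ∸ 1))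
W-B : ℕ → ℕ → VertexSet
W-B a b x = (not (x <ᵇ a) ∧ (x <ᵇ b)) ∨ (x ≡ᵇ (a ∸ 1)) ∨ (x ≡ᵇ b)

-- B_Q on ordered pairs x < y: (V_R × V_L) ∪ (V_B × V_T)
-- with V_R = {0,…,a-1}, V_B = {a,…,b-1}, V_L = {b,…,c-1}, V_T = {c,…,n-1}.
B-Q : ℕ → ℕ → ℕ → ℕ → EdgeSet
B-Q n a b c x y =
  ((x <ᵇ a) ∧ not (y <ᵇ b) ∧ (y <ᵇ c))
  ∨ (not (x <ᵇ a) ∧ (x <ᵇ b) ∧ not (y <ᵇ c) ∧ (y <ᵇ n))

B-M : ℕ → ℕ → ℕ → ℕ → EdgeSet → EdgeSet → EdgeSet
B-M n a b c BT BB x y =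
  (B-Q n a b c x y
    ∧ not ((x ≡ᵇ 0) ∧ (y ≡ᵇ (c ∸ 1)))
    ∧ not ((x ≡ᵇ (a ∸ 1)) ∧ (y ≡ᵇ b)))
  ∨ BT x y ∨ BB x y

-- Blocking: splitting ears off the side (0, n − 1) of any triangulation yields an edge from
-- V_R to V_L or from V_B to V_T. It lies in B_M unless it is a cut (0, c − 1) or (a − 1, b),
-- and then the triangulation restricts to a triangulation of that sub-polygon, which meets
-- B_T or B_B. Saturation: for an edge of B_Q, fans give a triangulation meeting B_M in that
-- edge only; for an edge e of B_T (B_B), gluing any triangulation of the sub-polygon to a
-- fixed B_M-free triangulation of the rest turns a blocker B_M ∖ {e} into a blocker
-- B_T ∖ {e} (B_B ∖ {e}). For the size, B_Q consists of two disjoint rectangles.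
module Submission where

open import Defs
open import Data.Bool using (Bool; true; false; _∧_; _∨_; not; if_then_else_)
open import Data.Bool.Properties using (T-≡; ∧-comm; ∧-assoc) renaming (_≟_ to _≟ᵇ_)
open import Data.Empty using (⊥; ⊥-elim)
open import Data.List using (map; upTo; _++_; [_])
open import Data.List.Properties using (upTo-∷ʳ; map-++)
open import Data.Nat using (ℕ; zero; suc; _+_; _*_; _∸_; _<_; _≤_; z≤n; s≤s; _<?_; _≟_; _≤?_; _<ᵇ_; _≡ᵇ_)
open import Data.Nat using (_≤′_; ≤′-refl; ≤′-step; _<‴_; ≤‴-refl; ≤‴-step)
open import Data.Nat.ListAction using (sum)
open import Data.Nat.ListAction.Properties using (sum-++)
open import Data.Nat.Properties
open import Data.Nat.Solver using (module +-*-Solver)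
open import Data.Product using (Σ; _×_; _,_; proj₁; proj₂; ∃-syntax)
open import Data.Sum using (_⊎_; inj₁; inj₂; [_,_]′) renaming (map to map-⊎)
open import Function using (_∘_; id)
open import Function.Bundles using (Equivalence)
open import Relation.Binary.Definitions using (tri<; tri≈; tri>)
open import Relation.Binary.PropositionalEquality using (_≡_; refl; sym; trans; cong; cong₂; subst; _≢_; module ≡-Reasoning)
open import Relation.Nullary using (¬_; Dec; yes; no)
open import Relation.Nullary.Decidable using (_⊎-dec_)
open import Algebra.Properties.CommutativeSemigroup +-commutativeSemigroup using (interchange)
open Equivalence using (to; from)

∨⁻ : ∀ {x y} → x ∨ y ≡ true → x ≡ true ⊎ y ≡ true
∨⁻ {true} _ = inj₁ refl
∨⁻ {false} p = inj₂ p

∨⁺ˡ : ∀ {x y} → x ≡ true → x ∨ y ≡ true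
∨⁺ˡ refl = refl

∨⁺ʳ : ∀ {x y} → y ≡ true → x ∨ y ≡ true
∨⁺ʳ {true} _ = refl
∨⁺ʳ {false} p = p

∧⁻ : ∀ {x y} → x ∧ y ≡ true → x ≡ true × y ≡ true
∧⁻ {true} p = refl , p

∧⁺ : ∀ {x y} → x ≡ true → y ≡ true → x ∧ y ≡ true
∧⁺ refl p = p

not⁻ : ∀ {x} → not x ≡ true → ¬ x ≡ true
not⁻ {false} _ ()

not⁺ : ∀ {x} → ¬ x ≡ true → not x ≡ true
not⁺ {true} f = ⊥-elim (f refl)
not⁺ {false} _ = refl

<ᵇ⁻ : ∀ {x y} → (x <ᵇ y) ≡ true → x < y
<ᵇ⁻ {x} {y} p = <ᵇ⇒< x y (from T-≡ p)

<ᵇ⁺ : ∀ {x y} → x < y → (x <ᵇ y) ≡ true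
<ᵇ⁺ x<y = to T-≡ (<⇒<ᵇ x<y)

≮ᵇ⁻ : ∀ {x y} → not (x <ᵇ y) ≡ true → y ≤ x
≮ᵇ⁻ p = ≮⇒≥ (λ x<y → not⁻ p (<ᵇ⁺ x<y))

≮ᵇ⁺ : ∀ {x y} → y ≤ x → not (x <ᵇ y) ≡ true
≮ᵇ⁺ y≤x = not⁺ (λ p → <⇒≱ (<ᵇ⁻ p) y≤x)

≡ᵇ⁻ : ∀ {x y} → (x ≡ᵇ y) ≡ true → x ≡ y
≡ᵇ⁻ {x} {y} p = ≡ᵇ⇒≡ x y (from T-≡ p)

≡ᵇ⁺ : ∀ {x y} → x ≡ y → (x ≡ᵇ y) ≡ true
≡ᵇ⁺ {x} {y} p = to T-≡ (≡⇒≡ᵇ x y p)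

<ᵇ-false : ∀ {x y} → y ≤ x → (x <ᵇ y) ≡ false
<ᵇ-false {x} {y} y≤x with x <ᵇ y in e
... | true = ⊥-elim (<⇒≱ (<ᵇ⁻ e) y≤x)
... | false = refl

≡ᵇ-false : ∀ {x y} → x ≢ y → (x ≡ᵇ y) ≡ false
≡ᵇ-false {x} {y} x≢y with x ≡ᵇ y in e
... | true = ⊥-elim (x≢y (≡ᵇ⁻ e))
... | false = refl

singletonₑ : ℕ → ℕ → EdgeSet
singletonₑ i j x y = (x ≡ᵇ i) ∧ (y ≡ᵇ j)

singletonₑ⁻ : ∀ {i j x y} → singletonₑ i j x y ≡ true → x ≡ i × y ≡ j
singletonₑ⁻ e = let (p , q) = ∧⁻ e in ≡ᵇ⁻ p , ≡ᵇ⁻ q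

singletonₑ⁺ : ∀ {i j} → singletonₑ i j i j ≡ true
singletonₑ⁺ {i} {j} = ∧⁺ (≡ᵇ⁺ {i} refl) (≡ᵇ⁺ {j} refl)

¬singletonₑ⁻ : ∀ {i j x y} → not (singletonₑ i j x y) ≡ true → ¬ (x ≡ i × y ≡ j)
¬singletonₑ⁻ {i} {j} p (refl , refl) = not⁻ p (singletonₑ⁺ {i} {j})

¬singletonₑ⁺ : ∀ {i j x y} → ¬ (x ≡ i × y ≡ j) → not (singletonₑ i j x y) ≡ true
¬singletonₑ⁺ {i} {j} h = not⁺ (λ e → h (singletonₑ⁻ {i} {j} e))

remove⁻ : ∀ {B i j x y} → remove B i j x y ≡ true → B x y ≡ true × ¬ (x ≡ i × y ≡ j)
remove⁻ {B} {i} {j} {x} {y} e = let (u , v) = ∧⁻ {B x y} e in u , ¬singletonₑ⁻ {i} {j} v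

remove⁺ : ∀ {B i j x y} → B x y ≡ true → ¬ (x ≡ i × y ≡ j) → remove B i j x y ≡ true
remove⁺ {i = i} {j} u v = ∧⁺ u (¬singletonₑ⁺ {i} {j} v)

_∪ₑ_ : EdgeSet → EdgeSet → EdgeSet
(A ∪ₑ B) x y = A x y ∨ B x y

∪ₑ⁻ : ∀ {A B x y} → (A ∪ₑ B) x y ≡ true → A x y ≡ true ⊎ B x y ≡ true
∪ₑ⁻ {A} {x = x} {y} = ∨⁻ {A x y}

∪ₑ⁺ˡ : ∀ {A B x y} → A x y ≡ true → (A ∪ₑ B) x y ≡ true
∪ₑ⁺ˡ = ∨⁺ˡ

∪ₑ⁺ʳ : ∀ {A B x y} → B x y ≡ true → (A ∪ₑ B) x y ≡ true
∪ₑ⁺ʳ {A} {x = x} {y} = ∨⁺ʳ {A x y}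

Cross-sym : ∀ {i j k l} → Cross i j k l → Cross k l i j
Cross-sym (inj₁ p) = inj₂ p
Cross-sym (inj₂ p) = inj₁ p

Cross-irrefl : ∀ {i j} → ¬ Cross i j i j
Cross-irrefl (inj₁ (i<i , _)) = <-irrefl refl i<i
Cross-irrefl (inj₂ (i<i , _)) = <-irrefl refl i<i

¬Cross-apart : ∀ {x y z w} → x < y → y ≤ z → ¬ Cross x y z w × ¬ Cross z w x y
¬Cross-apart x<y y≤z =
  (λ { (inj₁ (_ , z<y , _)) → <⇒≱ z<y y≤z
     ; (inj₂ (z<x , _ , _)) → <⇒≱ (<-trans z<x x<y) y≤z })
  , (λ { (inj₁ (z<x , _ , _)) → <⇒≱ (<-trans z<x x<y) y≤z
       ; (inj₂ (_ , z<y , _)) → <⇒≱ z<y y≤z })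

¬Cross-nested : ∀ {i j z w} → i ≤ z → w ≤ j → ¬ Cross i j z w × ¬ Cross z w i j
¬Cross-nested i≤z w≤j =
  (λ { (inj₁ (_ , _ , j<w)) → <⇒≱ j<w w≤j
     ; (inj₂ (z<i , _ , _)) → <⇒≱ z<i i≤z })
  , (λ { (inj₁ (z<i , _ , _)) → <⇒≱ z<i i≤z
       ; (inj₂ (_ , _ , j<w)) → <⇒≱ j<w w≤j })

Cross⇒inside⊎Cross : ∀ {u v p q x y} → u ≤ p → q ≤ v → Cross p q x y → (u ≤ x × y ≤ v) ⊎ Cross u v x y
Cross⇒inside⊎Cross {u} {v} {x = x} {y} u≤p q≤v (inj₁ (p<x , x<q , q<y)) with v <? y
... | yes v<y = inj₂ (inj₁ (≤-<-trans u≤p p<x , <-≤-trans x<q q≤v , v<y))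
... | no v≮y = inj₁ (≤-trans u≤p (<⇒≤ p<x) , ≮⇒≥ v≮y)
Cross⇒inside⊎Cross {u} {v} {x = x} {y} u≤p q≤v (inj₂ (x<p , p<y , y<q)) with x <? u
... | yes x<u = inj₂ (inj₂ (x<u , ≤-<-trans u≤p p<y , <-≤-trans y<q q≤v))
... | no x≮u = inj₁ (≮⇒≥ x≮u , ≤-trans (<⇒≤ y<q) q≤v)

NonCrossing-∪ₑ : ∀ {A B} → NonCrossing A → NonCrossing B
  → (∀ x y z w → A x y ≡ true → B z w ≡ true → ¬ Cross x y z w × ¬ Cross z w x y)
  → NonCrossing (A ∪ₑ B)
NonCrossing-∪ₑ {A} {B} ncA ncB h x y z w e f with ∪ₑ⁻ {A} {B} e | ∪ₑ⁻ {A} {B} f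
... | inj₁ u | inj₁ v = ncA x y z w u v
... | inj₂ u | inj₂ v = ncB x y z w u v
... | inj₁ u | inj₂ v = proj₁ (h x y z w u v)
... | inj₂ u | inj₁ v = proj₂ (h z w x y v u)

NonCrossing-singletonₑ : ∀ {l h} → NonCrossing (singletonₑ l h)
NonCrossing-singletonₑ {l} {h} x y z w e f with singletonₑ⁻ {l} {h} {x} {y} e | singletonₑ⁻ {l} {h} {z} {w} f
... | refl , refl | refl , refl = Cross-irrefl

DiagonalSet-∪ₑ : ∀ {W A B} → DiagonalSet W A → DiagonalSet W B → DiagonalSet W (A ∪ₑ B)
DiagonalSet-∪ₑ {A = A} {B} dA dB x y e = [ dA x y , dB x y ]′ (∪ₑ⁻ {A} {B} e)

DiagonalSet-singletonₑ : ∀ {W l h} → Diagonal W l h → DiagonalSet W (singletonₑ l h)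
DiagonalSet-singletonₑ {l = l} {h} d x y e with singletonₑ⁻ {l} {h} {x} {y} e
... | refl , refl = d

SideOr : EdgeSet → ℕ → ℕ → Set
SideOr S x y = y ≡ suc x ⊎ S x y ≡ true

SideOr-gap : ∀ {S x y} → SideOr S x y → suc x < y → S x y ≡ true
SideOr-gap (inj₁ refl) sx<y = ⊥-elim (<-irrefl refl sx<y)
SideOr-gap (inj₂ s) _ = s

SideOr? : ∀ S x y → Dec (SideOr S x y)
SideOr? S x y = (y ≟ suc x) ⊎-dec (S x y ≟ᵇ true)

-- The conditions on (p, q) say that it is a diagonal of the polygon i, i+1, …, j.
Complete : EdgeSet → ℕ → ℕ → Set
Complete S i j = ∀ p q → i ≤ p → q ≤ j → suc p < q → (i < p ⊎ q < j)
  → (∀ x y → S x y ≡ true → ¬ Cross p q x y) → S p q ≡ true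

Complete-mono : ∀ {S S' i j} → S' ⊆ₑ S → Complete S' i j → Complete S i j
Complete-mono S'⊆S c p q i≤p q≤j gap inner nc =
  S'⊆S p q (c p q i≤p q≤j gap inner (λ x y s → nc x y (S'⊆S x y s)))

Complete-side : ∀ {S i} → Complete S i (suc i)
Complete-side p q i≤p q≤si (s≤s p<q) _ _ = ⊥-elim (<⇒≱ (≤-<-trans i≤p p<q) (≤-pred q≤si))

-- A diagonal (p, q) of [i, j] not crossing (i, k) and (k, j) lies in [i, k] or in [k, j].
Complete-glue : ∀ {S i k j} → i < k → k < j → SideOr S i k → SideOr S k j
  → Complete S i k → Complete S k j → Complete S i j
Complete-glue {S} {i} {k} {j} i<k k<j sik skj cik ckj p q i≤p q≤j gap inner nc
  with m≤n⇒m<n∨m≡n i≤p | <-cmp q k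
... | inj₁ i<p | tri< q<k _ _ = cik p q i≤p (<⇒≤ q<k) gap (inj₁ i<p) nc
... | inj₁ i<p | tri≈ _ q≡k _ = cik p q i≤p (≤-reflexive q≡k) gap (inj₁ i<p) nc
... | inj₂ refl | tri< q<k _ _ = cik p q i≤p (<⇒≤ q<k) gap (inj₂ q<k) nc
... | inj₂ refl | tri≈ _ refl _ = SideOr-gap {S} sik gap
... | inj₂ refl | tri> _ _ k<q with inner
...   | inj₁ i<i = ⊥-elim (<-irrefl refl i<i)
...   | inj₂ q<j = ⊥-elim (nc k j (SideOr-gap {S} skj (≤-<-trans k<q q<j)) (inj₁ (i<k , k<q , q<j)))
Complete-glue {S} {i} {k} {j} i<k k<j sik skj cik ckj p q i≤p q≤j gap inner nc
  | inj₁ i<p | tri> _ _ k<q with <-cmp p k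
... | tri< p<k _ _ = ⊥-elim (nc i k (SideOr-gap {S} sik (≤-<-trans i<p p<k)) (inj₂ (i<p , p<k , k<q)))
... | tri> _ _ k<p = ckj p q (<⇒≤ k<p) q≤j gap (inj₁ k<p) nc
... | tri≈ _ refl _ with m≤n⇒m<n∨m≡n q≤j
...   | inj₁ q<j = ckj p q ≤-refl q≤j gap (inj₂ q<j) nc
...   | inj₂ refl = SideOr-gap {S} skj gap

-- A triangulation of the polygon i, i+1, …, j: 'node k l r' is the triangle (i, k, j)
-- together with triangulations of [i, k] and [k, j].
data Tree : ℕ → ℕ → Set where
  side : ∀ i → Tree i (suc i)
  node : ∀ {i j} k → Tree i k → Tree k j → Tree i j

mutual
  diagonals : ∀ {i j} → Tree i j → EdgeSet
  diagonals (side _) x y = false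
  diagonals (node k l r) x y = edges l x y ∨ edges r x y

  edges : ∀ {i j} → Tree i j → EdgeSet
  edges (side _) x y = false
  edges {i} {j} t@(node _ _ _) x y = diagonals t x y ∨ singletonₑ i j x y

Tree-< : ∀ {i j} → Tree i j → i < j
Tree-< (side i) = n<1+n i
Tree-< (node k l r) = <-trans (Tree-< l) (Tree-< r)

diagonals⊆edges : ∀ {i j} (t : Tree i j) → diagonals t ⊆ₑ edges t
diagonals⊆edges (side _) x y ()
diagonals⊆edges (node _ _ _) x y = ∨⁺ˡ

edges-root : ∀ {i k j} (l : Tree i k) (r : Tree k j) → edges (node k l r) i j ≡ true
edges-root {i} {k} {j} l r = ∨⁺ʳ {diagonals (node k l r) i j} (singletonₑ⁺ {i} {j})

edges-base : ∀ {i j} (t : Tree i j) → suc i < j → edges t i j ≡ true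
edges-base (side i) si<si = ⊥-elim (<-irrefl refl si<si)
edges-base (node _ l r) _ = edges-root l r

edgesˡ⊆diagonals : ∀ {i k j} (l : Tree i k) (r : Tree k j) → edges l ⊆ₑ diagonals (node k l r)
edgesˡ⊆diagonals l r x y = ∨⁺ˡ

edgesʳ⊆diagonals : ∀ {i k j} (l : Tree i k) (r : Tree k j) → edges r ⊆ₑ diagonals (node k l r)
edgesʳ⊆diagonals l r x y = ∨⁺ʳ {edges l x y}

edges-node⁻ : ∀ {i k j} (l : Tree i k) (r : Tree k j) {x y} → edges (node k l r) x y ≡ true
  → edges l x y ≡ true ⊎ edges r x y ≡ true ⊎ (x ≡ i × y ≡ j)
edges-node⁻ {i} {k} {j} l r {x} {y} e with ∨⁻ e
... | inj₂ b = inj₂ (inj₂ (singletonₑ⁻ {i} {j} b))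
... | inj₁ d with ∨⁻ {edges l x y} d
...   | inj₁ u = inj₁ u
...   | inj₂ u = inj₂ (inj₁ u)

edges-bounds : ∀ {i j} (t : Tree i j) {x y} → edges t x y ≡ true → i ≤ x × suc x < y × y ≤ j
edges-bounds (side i) ()
edges-bounds (node k l r) e with edges-node⁻ l r e
... | inj₁ u = let (a , g , c) = edges-bounds l u in a , g , ≤-trans c (<⇒≤ (Tree-< r))
... | inj₂ (inj₁ u) = let (a , g , c) = edges-bounds r u in ≤-trans (<⇒≤ (Tree-< l)) a , g , c
... | inj₂ (inj₂ (refl , refl)) = ≤-refl , ≤-<-trans (Tree-< l) (Tree-< r) , ≤-refl

diagonals-bounds : ∀ {i j} (t : Tree i j) {x y} → diagonals t x y ≡ true
  → i ≤ x × suc x < y × y ≤ j × (i < x ⊎ y < j)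
diagonals-bounds (side i) ()
diagonals-bounds (node k l r) {x} {y} d with ∨⁻ {edges l x y} d
... | inj₁ u = let (a , g , c) = edges-bounds l u
  in a , g , ≤-trans c (<⇒≤ (Tree-< r)) , inj₂ (≤-<-trans c (Tree-< r))
... | inj₂ u = let (a , g , c) = edges-bounds r u
  in ≤-trans (<⇒≤ (Tree-< l)) a , g , c , inj₁ (<-≤-trans (Tree-< l) a)

edges-nonCrossing : ∀ {i j} (t : Tree i j) → NonCrossing (edges t)
edges-nonCrossing (side i) x y z w ()
edges-nonCrossing (node k l r) x y z w e f with edges-node⁻ l r e | edges-node⁻ l r f
... | inj₂ (inj₂ (refl , refl)) | _ =
  let (a , _ , c) = edges-bounds (node k l r) f in proj₁ (¬Cross-nested a c)
... | _ | inj₂ (inj₂ (refl , refl)) =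
  let (a , _ , c) = edges-bounds (node k l r) e in proj₂ (¬Cross-nested a c)
... | inj₁ u | inj₁ v = edges-nonCrossing l x y z w u v
... | inj₂ (inj₁ u) | inj₂ (inj₁ v) = edges-nonCrossing r x y z w u v
... | inj₁ u | inj₂ (inj₁ v) =
  let (_ , g , c) = edges-bounds l u ; (a , _ , _) = edges-bounds r v
  in proj₁ (¬Cross-apart (<-trans (n<1+n _) g) (≤-trans c a))
... | inj₂ (inj₁ u) | inj₁ v =
  let (_ , g , c) = edges-bounds l v ; (a , _ , _) = edges-bounds r u
  in proj₂ (¬Cross-apart (<-trans (n<1+n _) g) (≤-trans c a))

diagonals-nonCrossing : ∀ {i j} (t : Tree i j) → NonCrossing (diagonals t)
diagonals-nonCrossing t x y z w d e =
  edges-nonCrossing t x y z w (diagonals⊆edges t x y d) (diagonals⊆edges t z w e)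

SideOr-left : ∀ {i k j} (l : Tree i k) (r : Tree k j) → SideOr (diagonals (node k l r)) i k
SideOr-left (side i) r = inj₁ refl
SideOr-left (node _ l' r') r = inj₂ (edgesˡ⊆diagonals (node _ l' r') r _ _ (edges-root l' r'))

SideOr-right : ∀ {i k j} (l : Tree i k) (r : Tree k j) → SideOr (diagonals (node k l r)) k j
SideOr-right l (side k) = inj₁ refl
SideOr-right l (node _ l' r') = inj₂ (edgesʳ⊆diagonals l (node _ l' r') _ _ (edges-root l' r'))

Complete-diagonals : ∀ {i j} (t : Tree i j) → Complete (diagonals t) i j
Complete-diagonals (side i) = Complete-side
Complete-diagonals (node k l r) = Complete-glue (Tree-< l) (Tree-< r) (SideOr-left l r) (SideOr-right l r)
  (Complete-mono (λ x y d → edgesˡ⊆diagonals l r x y (diagonals⊆edges l x y d)) (Complete-diagonals l))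
  (Complete-mono (λ x y d → edgesʳ⊆diagonals l r x y (diagonals⊆edges r x y d)) (Complete-diagonals r))

Complete-edges : ∀ {i j} (t : Tree i j) → Complete (edges t) i j
Complete-edges t = Complete-mono (diagonals⊆edges t) (Complete-diagonals t)

AllEdges : (ℕ → ℕ → Set) → ∀ {i j} → Tree i j → Set
AllEdges P t = ∀ x y → edges t x y ≡ true → P x y

AllDiagonals : (ℕ → ℕ → Set) → ∀ {i j} → Tree i j → Set
AllDiagonals P t = ∀ x y → diagonals t x y ≡ true → P x y

AllEdges-side : ∀ {P} i → AllEdges P (side i)
AllEdges-side i x y ()

AllDiagonals-node : ∀ {P i k j} (l : Tree i k) (r : Tree k j)
  → AllEdges P l → AllEdges P r → AllDiagonals P (node k l r)
AllDiagonals-node l r al ar x y d with ∨⁻ d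
... | inj₁ u = al x y u
... | inj₂ u = ar x y u

AllEdges-node : ∀ {P i k j} (l : Tree i k) (r : Tree k j)
  → AllEdges P l → AllEdges P r → P i j → AllEdges P (node k l r)
AllEdges-node l r al ar pij x y e with edges-node⁻ l r e
... | inj₁ u = al x y u
... | inj₂ (inj₁ u) = ar x y u
... | inj₂ (inj₂ (refl , refl)) = pij

extend : ∀ {i k j} → Tree i k → k ≤′ j → Tree i j
extend t ≤′-refl = t
extend t (≤′-step {j} p) = node j (extend t p) (side j)

AllEdges-extend : ∀ {P i k j} (t : Tree i k) (p : k ≤′ j) → AllEdges P t
  → (∀ y → k < y → y ≤ j → P i y) → AllEdges P (extend t p)
AllEdges-extend t ≤′-refl at h = at
AllEdges-extend t (≤′-step {j} p) at h =
  AllEdges-node (extend t p) (side j) (AllEdges-extend t p at (λ y k<y y≤j → h y k<y (m≤n⇒m≤1+n y≤j)))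
    (AllEdges-side j) (h (suc j) (s≤s (≤′⇒≤ p)) ≤-refl)

fanFrom : ∀ {i j} → i < j → Tree i j
fanFrom {i} i<j = extend (side i) (≤⇒≤′ i<j)

AllEdges-fanFrom : ∀ {P i j} (i<j : i < j) → (∀ y → suc i < y → y ≤ j → P i y) → AllEdges P (fanFrom i<j)
AllEdges-fanFrom {i = i} i<j = AllEdges-extend (side i) (≤⇒≤′ i<j) (AllEdges-side i)

fanTo‴ : ∀ {i j} → i <‴ j → Tree i j
fanTo‴ {i} ≤‴-refl = side i
fanTo‴ {i} (≤‴-step p) = node (suc i) (side i) (fanTo‴ p)

AllEdges-fanTo‴ : ∀ {P i j} (p : i <‴ j) → (∀ x → i ≤ x → suc x < j → P x j) → AllEdges P (fanTo‴ p)
AllEdges-fanTo‴ {i = i} ≤‴-refl h = AllEdges-side i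
AllEdges-fanTo‴ {i = i} {j} (≤‴-step p) h =
  AllEdges-node (side i) (fanTo‴ p) (AllEdges-side i) (AllEdges-fanTo‴ p (λ x si≤x → h x (≤-trans (n≤1+n i) si≤x)))
    (h i ≤-refl (≤‴⇒≤ p))

fanTo : ∀ {i j} → i < j → Tree i j
fanTo i<j = fanTo‴ (≤⇒≤‴ i<j)

AllEdges-fanTo : ∀ {P i j} (i<j : i < j) → (∀ x → i ≤ x → suc x < j → P x j) → AllEdges P (fanTo i<j)
AllEdges-fanTo i<j = AllEdges-fanTo‴ (≤⇒≤‴ i<j)

diagonal⁻ : ∀ {m p q} → Diagonal (polygon (suc m)) p q → suc p < q × q ≤ m × (0 < p ⊎ q < m)
diagonal⁻ (_ , _ , wq , (k , p<k , k<q , _) , (k' , outside , wk')) =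
  ≤-<-trans p<k k<q , ≤-pred (<ᵇ⁻ wq)
  , map-⊎ (≤-<-trans z≤n) (λ q<k' → <-≤-trans q<k' (≤-pred (<ᵇ⁻ wk'))) outside

diagonal⁺ : ∀ {m p q} → suc p < q → q ≤ m → (0 < p ⊎ q < m) → Diagonal (polygon (suc m)) p q
diagonal⁺ {m} {p} {q} sp<q q≤m outside =
  p<q , <ᵇ⁺ (<-trans p<q (s≤s q≤m)) , <ᵇ⁺ (s≤s q≤m)
  , (suc p , n<1+n p , sp<q , <ᵇ⁺ (<-trans sp<q (s≤s q≤m))) , vertex-outside outside
  where
  p<q = <-trans (n<1+n p) sp<q
  vertex-outside : 0 < p ⊎ q < m → ∃[ k ] ((k < p ⊎ q < k) × polygon (suc m) k ≡ true)
  vertex-outside (inj₁ 0<p) = 0 , inj₁ 0<p , <ᵇ⁺ (s≤s (z≤n {m}))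
  vertex-outside (inj₂ q<m) = m , inj₂ q<m , <ᵇ⁺ (n<1+n m)

Diagonal-polygon : ∀ {W m x y} → (∀ z → W z ≡ true → z ≤ m) → Diagonal W x y → Diagonal (polygon (suc m)) x y
Diagonal-polygon {W} {m} W≤m (x<y , wx , wy , (k , x<k , k<y , wk) , (k' , outside , wk')) =
  x<y , in-polygon wx , in-polygon wy , (k , x<k , k<y , in-polygon wk) , (k' , outside , in-polygon wk')
  where in-polygon : ∀ {z} → W z ≡ true → polygon (suc m) z ≡ true
        in-polygon {z} wz = <ᵇ⁺ (s≤s (W≤m z wz))

Complete⇒Triangulation : ∀ {m} S → DiagonalSet (polygon (suc m)) S → NonCrossing S → Complete S 0 m
  → Triangulation (polygon (suc m)) S
Complete⇒Triangulation S diag nc complete = diag , nc , λ T' diagT' ncT' S⊆T' p q t'pq →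
  let (gap , q≤m , outside) = diagonal⁻ (diagT' p q t'pq)
  in complete p q z≤n q≤m gap outside (λ x y s → ncT' p q x y t'pq (S⊆T' x y s))

diagonals-triangulation : ∀ {m} (t : Tree 0 m) → Triangulation (polygon (suc m)) (diagonals t)
diagonals-triangulation t = Complete⇒Triangulation (diagonals t)
  (λ x y d → let (_ , gap , y≤m , outside) = diagonals-bounds t d in diagonal⁺ gap y≤m outside)
  (diagonals-nonCrossing t) (Complete-diagonals t)

Triangulation-closed : ∀ {W T p q} → Triangulation W T → Diagonal W p q
  → (∀ x y → T x y ≡ true → ¬ Cross p q x y) → T p q ≡ true
Triangulation-closed {W} {T} {p} {q} (diag , nc , maximal) dpq ok =
  maximal (T ∪ₑ singletonₑ p q) (DiagonalSet-∪ₑ {A = T} diag (DiagonalSet-singletonₑ dpq))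
    (NonCrossing-∪ₑ {T} nc NonCrossing-singletonₑ ok′) (λ x y → ∪ₑ⁺ˡ {T} {singletonₑ p q})
    p q (∪ₑ⁺ʳ {T} {singletonₑ p q} (singletonₑ⁺ {p} {q}))
  where
  ok′ : ∀ x y z w → T x y ≡ true → singletonₑ p q z w ≡ true → ¬ Cross x y z w × ¬ Cross z w x y
  ok′ x y z w t s with singletonₑ⁻ {p} {q} {z} {w} s
  ... | refl , refl = (λ cr → ok x y t (Cross-sym cr)) , ok x y t

Within : EdgeSet → ℕ → ℕ → Set
Within S l h = ∀ x y → S x y ≡ true → l ≤ x × x < y × y ≤ h

Within-∪ₑ : ∀ {A B l h} → Within A l h → Within B l h → Within (A ∪ₑ B) l h
Within-∪ₑ {A} {B} wA wB x y e = [ wA x y , wB x y ]′ (∪ₑ⁻ {A} {B} e)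

Within-widen : ∀ {S l h l′ h′} → l′ ≤ l → h ≤ h′ → Within S l h → Within S l′ h′
Within-widen l′≤l h≤h′ w x y e = let (l≤x , x<y , y≤h) = w x y e in ≤-trans l′≤l l≤x , x<y , ≤-trans y≤h h≤h′

Within-singletonₑ : ∀ {l h} → l < h → Within (singletonₑ l h) l h
Within-singletonₑ {l} {h} l<h x y e with singletonₑ⁻ {l} {h} {x} {y} e
... | refl , refl = ≤-refl , l<h , ≤-refl

Within-edges : ∀ {l h} (t : Tree l h) → Within (edges t) l h
Within-edges t x y e = let (l≤x , sx<y , y≤h) = edges-bounds t e in l≤x , <-trans (n<1+n x) sx<y , y≤h

NonCrossing-∪ₑ-apart : ∀ {A B l k h} → NonCrossing A → NonCrossing B → Within A l k → Within B k h
  → NonCrossing (A ∪ₑ B)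
NonCrossing-∪ₑ-apart ncA ncB wA wB = NonCrossing-∪ₑ ncA ncB λ x y z w a b →
  let (_ , x<y , y≤k) = wA x y a ; (k≤z , _ , _) = wB z w b in ¬Cross-apart x<y (≤-trans y≤k k≤z)

NonCrossing-∪ₑ-around : ∀ {A l h} → NonCrossing A → Within A l h → NonCrossing (A ∪ₑ singletonₑ l h)
NonCrossing-∪ₑ-around {A} {l} {h} ncA wA = NonCrossing-∪ₑ ncA NonCrossing-singletonₑ λ x y z w a s →
  let (l≤x , _ , y≤h) = wA x y a in around (¬Cross-nested l≤x y≤h) (singletonₑ⁻ {l} {h} s)
  where
  around : ∀ {x y z w} → ¬ Cross l h x y × ¬ Cross x y l h → z ≡ l × w ≡ h → ¬ Cross x y z w × ¬ Cross z w x y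
  around (p , q) (refl , refl) = q , p

DiagonalSet-edges : ∀ {m l h} (t : Tree l h) → h ≤ m → (0 < l ⊎ h < m) → DiagonalSet (polygon (suc m)) (edges t)
DiagonalSet-edges t h≤m inner x y e =
  let (l≤x , sx<y , y≤h) = edges-bounds t e
  in diagonal⁺ sx<y (≤-trans y≤h h≤m) (map-⊎ (λ 0<l → <-≤-trans 0<l l≤x) (≤-<-trans y≤h) inner)

largest : ∀ {P : ℕ → Set} → (∀ x → Dec (P x)) → ∀ {a b} → a < b → P a
  → ∃[ k ] (a ≤ k × k < b × P k × (∀ x → k < x → x < b → ¬ P x))
largest {P} P? {a} {suc b} a<sb pa with m≤n⇒m<n∨m≡n (≤-pred a<sb)
... | inj₂ refl = a , ≤-refl , a<sb , pa , λ x a<x x<sa → ⊥-elim (<⇒≱ a<x (≤-pred x<sa))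
... | inj₁ a<b with P? b
...   | yes pb = b , <⇒≤ a<b , n<1+n b , pb , λ x b<x x<sb → ⊥-elim (<⇒≱ b<x (≤-pred x<sb))
...   | no ¬pb with largest P? a<b pa
...     | k , a≤k , k<b , pk , above = k , a≤k , <-trans k<b (n<1+n b) , pk , above′
  where
  above′ : ∀ x → k < x → x < suc b → ¬ P x
  above′ x k<x x<sb with m≤n⇒m<n∨m≡n (≤-pred x<sb)
  ... | inj₁ x<b = above x k<x x<b
  ... | inj₂ refl = ¬pb

-- Take k maximal with (i, k) a side or an edge of T; then (k, j) crosses nothing in T.
ear : ∀ {m T} → Triangulation (polygon (suc m)) T → ∀ {i j} → suc i < j → j ≤ m
  → (∀ x y → T x y ≡ true → ¬ Cross i j x y)
  → ∃[ k ] (i < k × k < j × SideOr T i k × SideOr T k j)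
ear {m} {T} tri {i} {j} si<j j≤m ok with largest (SideOr? T i) si<j (inj₁ refl)
... | k , i<k , k<j , sik , above = k , i<k , k<j , sik , skj
  where
  clear : ∀ x y → T x y ≡ true → ¬ Cross k j x y
  clear x y t (inj₁ (k<x , x<j , j<y)) = ok x y t (inj₁ (<-trans i<k k<x , x<j , j<y))
  clear x y t (inj₂ (x<k , k<y , y<j)) with <-cmp x i
  ... | tri< x<i _ _ = ok x y t (inj₂ (x<i , <-trans i<k k<y , y<j))
  ... | tri≈ _ refl _ = above y k<y y<j (inj₂ t)
  ... | tri> _ _ i<x =
    proj₁ (proj₂ tri) i k x y (SideOr-gap {T} sik (≤-<-trans i<x x<k)) t (inj₁ (i<x , x<k , k<y))
  skj : SideOr T k j
  skj with m≤n⇒m<n∨m≡n k<j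
  ... | inj₂ sk≡j = inj₁ (sym sk≡j)
  ... | inj₁ sk<j = inj₂ (Triangulation-closed tri (diagonal⁺ sk<j j≤m (inj₁ (≤-<-trans z≤n i<k))) clear)

ind : Bool → ℕ
ind x = if x then 1 else 0

ind-∧ : ∀ x y → ind (x ∧ y) ≡ ind x * ind y
ind-∧ true y = sym (+-identityʳ (ind y))
ind-∧ false y = refl

ind-∨ : ∀ x y → ¬ (x ≡ true × y ≡ true) → ind (x ∨ y) ≡ ind x + ind y
ind-∨ true true disjoint = ⊥-elim (disjoint (refl , refl))
ind-∨ true false _ = refl
ind-∨ false y _ = refl

ind-∧-not : ∀ x y → (y ≡ true → x ≡ true) → ind (x ∧ not y) + ind y ≡ ind x
ind-∧-not x true y⇒x rewrite y⇒x refl = refl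
ind-∧-not true false _ = refl
ind-∧-not false false _ = refl

∑< : ℕ → (ℕ → ℕ) → ℕ
∑< zero f = 0
∑< (suc n) f = ∑< n f + f n

∑<-cong : ∀ n {f g : ℕ → ℕ} → (∀ k → k < n → f k ≡ g k) → ∑< n f ≡ ∑< n g
∑<-cong zero h = refl
∑<-cong (suc n) h = cong₂ _+_ (∑<-cong n (λ k k<n → h k (m<n⇒m<1+n k<n))) (h n (n<1+n n))

∑<-const : ∀ n c → ∑< n (λ _ → c) ≡ n * c
∑<-const zero c = refl
∑<-const (suc n) c = trans (cong (_+ c) (∑<-const n c)) (+-comm (n * c) c)

∑<-+ : ∀ n (f g : ℕ → ℕ) → ∑< n (λ k → f k + g k) ≡ ∑< n f + ∑< n g
∑<-+ zero f g = refl
∑<-+ (suc n) f g = trans (cong (_+ (f n + g n)) (∑<-+ n f g)) (interchange (∑< n f) (∑< n g) (f n) (g n))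

∑<-*ˡ : ∀ n c (f : ℕ → ℕ) → ∑< n (λ k → c * f k) ≡ c * ∑< n f
∑<-*ˡ zero c f = sym (*-zeroʳ c)
∑<-*ˡ (suc n) c f = trans (cong (_+ c * f n) (∑<-*ˡ n c f)) (sym (*-distribˡ-+ c (∑< n f) (f n)))

∑<-*ʳ : ∀ n c (f : ℕ → ℕ) → ∑< n (λ k → f k * c) ≡ ∑< n f * c
∑<-*ʳ zero c f = refl
∑<-*ʳ (suc n) c f = trans (cong (_+ f n * c) (∑<-*ʳ n c f)) (sym (*-distribʳ-+ c (∑< n f) (f n)))

∑<-vanishing : ∀ {k} n (f : ℕ → ℕ) → k ≤ n → (∀ x → k ≤ x → x < n → f x ≡ 0) → ∑< n f ≡ ∑< k f
∑<-vanishing zero f z≤n _ = refl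
∑<-vanishing (suc n) f k≤sn zero-above with m≤n⇒m<n∨m≡n k≤sn
... | inj₂ refl = refl
... | inj₁ k<sn =
  trans (cong₂ _+_ (∑<-vanishing n f (≤-pred k<sn) (λ x k≤x x<n → zero-above x k≤x (m<n⇒m<1+n x<n)))
                   (zero-above n (≤-pred k<sn) (n<1+n n)))
        (+-identityʳ _)

∑<-<ᵇ : ∀ {a} N → a ≤ N → ∑< N (λ k → ind (k <ᵇ a)) ≡ a
∑<-<ᵇ {a} N a≤N = begin
  ∑< N (λ k → ind (k <ᵇ a)) ≡⟨ ∑<-vanishing N _ a≤N (λ x a≤x _ → cong ind (<ᵇ-false a≤x)) ⟩
  ∑< a (λ k → ind (k <ᵇ a)) ≡⟨ ∑<-cong a (λ k k<a → cong ind (<ᵇ⁺ k<a)) ⟩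
  ∑< a (λ _ → 1)            ≡⟨ ∑<-const a 1 ⟩
  a * 1                     ≡⟨ *-identityʳ a ⟩
  a ∎
  where open ≡-Reasoning

∑<-range : ∀ {l h} N → l ≤ h → h ≤ N → ∑< N (λ k → ind (not (k <ᵇ l) ∧ (k <ᵇ h))) ≡ h ∸ l
∑<-range {l} {h} N l≤h h≤N = begin
  ∑< N range                          ≡⟨ sym (m+n∸n≡m (∑< N range) (∑< N below-l)) ⟩
  ∑< N range + ∑< N below-l ∸ ∑< N below-l ≡⟨ cong₂ _∸_ split (∑<-<ᵇ N (≤-trans l≤h h≤N)) ⟩
  h ∸ l ∎
  where
  open ≡-Reasoning
  range below-l : ℕ → ℕ
  range k = ind (not (k <ᵇ l) ∧ (k <ᵇ h))
  below-l k = ind (k <ᵇ l)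
  pointwise : ∀ k → range k + below-l k ≡ ind (k <ᵇ h)
  pointwise k = trans (cong (λ z → ind z + below-l k) (∧-comm (not (k <ᵇ l)) (k <ᵇ h)))
    (ind-∧-not (k <ᵇ h) (k <ᵇ l) (λ k<l → <ᵇ⁺ (<-≤-trans (<ᵇ⁻ k<l) l≤h)))
  split : ∑< N range + ∑< N below-l ≡ h
  split = trans (sym (∑<-+ N range below-l)) (trans (∑<-cong N (λ k _ → pointwise k)) (∑<-<ᵇ N h≤N))

∑<-≡ᵇ : ∀ {p} N → p < N → ∑< N (λ k → ind (k ≡ᵇ p)) ≡ 1
∑<-≡ᵇ {p} N p<N = begin
  ∑< N (λ k → ind (k ≡ᵇ p))           ≡⟨ ∑<-vanishing N _ p<N (λ x p<x _ → cong ind (≡ᵇ-false (>⇒≢ p<x))) ⟩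
  ∑< p (λ k → ind (k ≡ᵇ p)) + ind (p ≡ᵇ p)
    ≡⟨ cong₂ _+_ (∑<-cong p (λ k k<p → cong ind (≡ᵇ-false (<⇒≢ k<p)))) (cong ind (≡ᵇ⁺ {p} refl)) ⟩
  ∑< p (λ _ → 0) + 1                  ≡⟨ cong (_+ 1) (trans (∑<-const p 0) (*-zeroʳ p)) ⟩
  1 ∎
  where open ≡-Reasoning

count : ℕ → (ℕ → ℕ → ℕ) → ℕ
count n F = ∑< n (λ j → ∑< j (λ i → F i j))

size-count : ∀ n S → size n S ≡ count n (λ i j → ind (S i j))
size-count n S = trans (sum-map-upTo _ n) (∑<-cong n (λ j _ → sum-map-upTo _ j))
  where
  sum-map-upTo : ∀ (f : ℕ → ℕ) n → sum (map f (upTo n)) ≡ ∑< n f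
  sum-map-upTo f zero = refl
  sum-map-upTo f (suc n) = begin
    sum (map f (upTo (suc n)))       ≡⟨ cong (sum ∘ map f) (sym (upTo-∷ʳ n)) ⟩
    sum (map f (upTo n ++ [ n ]))    ≡⟨ cong sum (map-++ f (upTo n) [ n ]) ⟩
    sum (map f (upTo n) ++ [ f n ])  ≡⟨ sum-++ (map f (upTo n)) [ f n ] ⟩
    sum (map f (upTo n)) + (f n + 0) ≡⟨ cong₂ _+_ (sum-map-upTo f n) (+-identityʳ (f n)) ⟩
    ∑< n f + f n ∎
    where open ≡-Reasoning

count-cong : ∀ n {F G : ℕ → ℕ → ℕ} → (∀ i j → F i j ≡ G i j) → count n F ≡ count n G
count-cong n h = ∑<-cong n (λ j _ → ∑<-cong j (λ i _ → h i j))

count-+ : ∀ n (F G : ℕ → ℕ → ℕ) → count n (λ i j → F i j + G i j) ≡ count n F + count n G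
count-+ n F G = trans (∑<-cong n (λ j _ → ∑<-+ j (λ i → F i j) (λ i → G i j))) (∑<-+ n _ _)

size-cong : ∀ n {S S′} → (∀ i j → S i j ≡ S′ i j) → size n S ≡ size n S′
size-cong n {S} {S′} h = trans (size-count n S) (trans (count-cong n (λ i j → cong ind (h i j))) (sym (size-count n S′)))

size-∪ₑ : ∀ n {A B} → (∀ i j → ¬ (A i j ≡ true × B i j ≡ true)) → size n (A ∪ₑ B) ≡ size n A + size n B
size-∪ₑ n {A} {B} disjoint = begin
  size n (A ∪ₑ B) ≡⟨ size-count n (A ∪ₑ B) ⟩
  count n (λ i j → ind (A i j ∨ B i j)) ≡⟨ count-cong n (λ i j → ind-∨ (A i j) (B i j) (disjoint i j)) ⟩
  count n (λ i j → ind (A i j) + ind (B i j)) ≡⟨ count-+ n _ _ ⟩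
  count n (λ i j → ind (A i j)) + count n (λ i j → ind (B i j)) ≡⟨ sym (cong₂ _+_ (size-count n A) (size-count n B)) ⟩
  size n A + size n B ∎
  where open ≡-Reasoning

size-× : ∀ n {k} (f g : ℕ → Bool) → (∀ x → f x ≡ true → x < k) → (∀ y → g y ≡ true → k ≤ y)
  → size n (λ x y → f x ∧ g y) ≡ ∑< k (ind ∘ f) * ∑< n (ind ∘ g)
size-× n {k} f g f<k k≤g = begin
  size n (λ x y → f x ∧ g y)                  ≡⟨ size-count n _ ⟩
  ∑< n (λ y → ∑< y (λ x → ind (f x ∧ g y)))   ≡⟨ ∑<-cong n (λ y _ → column y) ⟩
  ∑< n (λ y → ∑< k (ind ∘ f) * ind (g y))     ≡⟨ ∑<-*ˡ n (∑< k (ind ∘ f)) (ind ∘ g) ⟩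
  ∑< k (ind ∘ f) * ∑< n (ind ∘ g) ∎
  where
  open ≡-Reasoning
  f-zero : ∀ x → k ≤ x → ind (f x) ≡ 0
  f-zero x k≤x with f x in fx
  ... | true = ⊥-elim (<⇒≱ (f<k x fx) k≤x)
  ... | false = refl
  truncate : ∀ y → ∑< y (ind ∘ f) * ind (g y) ≡ ∑< k (ind ∘ f) * ind (g y)
  truncate y with g y in gy
  ... | true = cong (_* 1) (∑<-vanishing y (ind ∘ f) (k≤g y gy) (λ x k≤x _ → f-zero x k≤x))
  ... | false = trans (*-zeroʳ (∑< y (ind ∘ f))) (sym (*-zeroʳ (∑< k (ind ∘ f))))
  column : ∀ y → ∑< y (λ x → ind (f x ∧ g y)) ≡ ∑< k (ind ∘ f) * ind (g y)
  column y = trans (∑<-cong y (λ x _ → ind-∧ (f x) (g y))) (trans (∑<-*ʳ y (ind (g y)) (ind ∘ f)) (truncate y))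

size-singletonₑ : ∀ n {i j} → i < j → j < n → size n (singletonₑ i j) ≡ 1
size-singletonₑ n {i} {j} i<j j<n =
  trans (size-× n (_≡ᵇ i) (_≡ᵇ j) (λ x e → s≤s (≤-reflexive (≡ᵇ⁻ e)))
                                    (λ y e → subst (suc i ≤_) (sym (≡ᵇ⁻ e)) i<j))
        (cong₂ _*_ (∑<-≡ᵇ (suc i) (n<1+n i)) (∑<-≡ᵇ n j<n))

size-remove : ∀ n {S i j} → S i j ≡ true → i < j → j < n → size n (remove S i j) + 1 ≡ size n S
size-remove n {S} {i} {j} sij i<j j<n = begin
  size n (remove S i j) + 1
    ≡⟨ cong (size n (remove S i j) +_) (sym (size-singletonₑ n i<j j<n)) ⟩
  size n (remove S i j) + size n (singletonₑ i j)
    ≡⟨ cong₂ _+_ (size-count n (remove S i j)) (size-count n (singletonₑ i j)) ⟩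
  count n (λ x y → ind (remove S i j x y)) + count n (λ x y → ind (singletonₑ i j x y))
    ≡⟨ sym (count-+ n _ _) ⟩
  count n (λ x y → ind (S x y ∧ not (singletonₑ i j x y)) + ind (singletonₑ i j x y))
    ≡⟨ count-cong n (λ x y → ind-∧-not (S x y) (singletonₑ i j x y) (singleton⇒S x y)) ⟩
  count n (λ x y → ind (S x y))
    ≡⟨ sym (size-count n S) ⟩
  size n S ∎
  where
  open ≡-Reasoning
  singleton⇒S : ∀ x y → singletonₑ i j x y ≡ true → S x y ≡ true
  singleton⇒S x y e with singletonₑ⁻ {i} {j} {x} {y} e
  ... | refl , refl = sij

-- The n-gon has vertices 0, …, m and the paper's a, b, c are a₁ + 1, b₁ + 1, c₁ + 1,
-- so V_R = [0, a₁], V_B = [a₁ + 1, b₁], V_L = [b, c₁] and V_T = [c₁ + 1, m].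
module Construction (m a₁ b₁ c₁ : ℕ) (1<a₁ : 1 < a₁) (a+1<b : suc (suc a₁) < suc b₁)
  (b+2≤c₁ : suc (suc (suc b₁)) ≤ c₁) (c<m : suc c₁ < m) (BT BB : EdgeSet)
  (satT : SaturatedBlocker (W-T (suc m) (suc c₁)) BT)
  (satB : SaturatedBlocker (W-B (suc a₁) (suc b₁)) BB) where

  b : ℕ
  b = suc b₁

  WT WB : VertexSet
  WT = W-T (suc m) (suc c₁)
  WB = W-B (suc a₁) b

  BQ BM : EdgeSet
  BQ = B-Q (suc m) (suc a₁) b (suc c₁)
  BM = B-M (suc m) (suc a₁) b (suc c₁) BT BB

  P : VertexSet
  P = polygon (suc m)

  a<b : suc a₁ < b
  a<b = <-trans (n<1+n _) a+1<b
  a₁<b : a₁ < b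
  a₁<b = <-trans (n<1+n _) a<b
  b₁<b : b₁ < b
  b₁<b = n<1+n b₁
  a<b₁ : suc a₁ < b₁
  a<b₁ = ≤-pred a+1<b
  b<c₁ : b < c₁
  b<c₁ = <-trans (n<1+n _) b+2≤c₁
  c₁<m : c₁ < m
  c₁<m = <-trans (n<1+n _) c<m
  b≤m : b ≤ m
  b≤m = <⇒≤ (<-trans b<c₁ c₁<m)
  b<m : b < m
  b<m = <-trans b<c₁ c₁<m
  a₁<c₁ : a₁ < c₁
  a₁<c₁ = <-trans a₁<b b<c₁
  a<c₁ : suc a₁ < c₁
  a<c₁ = <-trans a<b b<c₁
  a₁<m : a₁ < m
  a₁<m = <-trans a₁<b b<m
  0<a₁ : 0 < a₁
  0<a₁ = <-trans (s≤s z≤n) 1<a₁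
  0<b : 0 < b
  0<b = s≤s z≤n
  0<c₁ : 0 < c₁
  0<c₁ = <-trans 0<a₁ a₁<c₁

  InT : ℕ → Set
  InT x = (x ≡ 0 ⊎ c₁ ≤ x) × x ≤ m

  WT⁻ : ∀ {x} → WT x ≡ true → InT x
  WT⁻ {x} e with ∨⁻ e
  ... | inj₁ u = let (p , q) = ∧⁻ u in inj₂ (≤-trans (n≤1+n c₁) (≮ᵇ⁻ p)) , ≤-pred (<ᵇ⁻ q)
  ... | inj₂ v with ∨⁻ v
  ...   | inj₁ w = inj₁ (≡ᵇ⁻ w) , subst (_≤ m) (sym (≡ᵇ⁻ w)) z≤n
  ...   | inj₂ w = inj₂ (≤-reflexive (sym (≡ᵇ⁻ w))) , subst (_≤ m) (sym (≡ᵇ⁻ w)) (<⇒≤ c₁<m)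

  WT⁺ : ∀ {x} → InT x → WT x ≡ true
  WT⁺ {x} (inj₁ refl , _) = ∨⁺ʳ {not (0 <ᵇ suc c₁) ∧ (0 <ᵇ suc m)} (∨⁺ˡ {0 ≡ᵇ 0} {0 ≡ᵇ c₁} refl)
  WT⁺ {x} (inj₂ c₁≤x , x≤m) with m≤n⇒m<n∨m≡n c₁≤x
  ... | inj₁ c₁<x = ∨⁺ˡ (∧⁺ (≮ᵇ⁺ c₁<x) (<ᵇ⁺ (s≤s x≤m)))
  ... | inj₂ refl = ∨⁺ʳ {not (x <ᵇ suc c₁) ∧ (x <ᵇ suc m)} (∨⁺ʳ {x ≡ᵇ 0} (≡ᵇ⁺ {x} refl))

  InT-gap : ∀ {z} → InT z → 0 < z → z < c₁ → ⊥
  InT-gap (inj₁ refl , _) () _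
  InT-gap (inj₂ c₁≤z , _) _ z<c₁ = <⇒≱ z<c₁ c₁≤z

  InT⊎Cross-cut : ∀ {x y} → x < y → c₁ < y → y ≤ m → InT x ⊎ Cross 0 c₁ x y
  InT⊎Cross-cut {x} {y} x<y c₁<y y≤m with x ≟ 0 | c₁ ≤? x
  ... | yes refl | _ = inj₁ (inj₁ refl , z≤n)
  ... | no _ | yes c₁≤x = inj₁ (inj₂ c₁≤x , ≤-trans (<⇒≤ x<y) y≤m)
  ... | no x≢0 | no c₁≰x = inj₂ (inj₁ (n≢0⇒n>0 x≢0 , ≰⇒> c₁≰x , c₁<y))

  InB : ℕ → Set
  InB x = a₁ ≤ x × x ≤ b

  WB⁻ : ∀ {x} → WB x ≡ true → InB x
  WB⁻ {x} e with ∨⁻ e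
  ... | inj₁ u = let (p , q) = ∧⁻ u in ≤-trans (n≤1+n a₁) (≮ᵇ⁻ p) , <⇒≤ (<ᵇ⁻ q)
  ... | inj₂ v with ∨⁻ v
  ...   | inj₁ w = ≤-reflexive (sym (≡ᵇ⁻ w)) , subst (_≤ b) (sym (≡ᵇ⁻ w)) (<⇒≤ a₁<b)
  ...   | inj₂ w = subst (a₁ ≤_) (sym (≡ᵇ⁻ w)) (<⇒≤ a₁<b) , ≤-reflexive (≡ᵇ⁻ w)

  WB⁺ : ∀ {x} → InB x → WB x ≡ true
  WB⁺ {x} (a₁≤x , x≤b) with m≤n⇒m<n∨m≡n a₁≤x | m≤n⇒m<n∨m≡n x≤b
  ... | inj₂ refl | _ = ∨⁺ʳ {not (x <ᵇ suc a₁) ∧ (x <ᵇ b)} (∨⁺ˡ (≡ᵇ⁺ {x} refl))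
  ... | inj₁ _ | inj₂ refl = ∨⁺ʳ {not (x <ᵇ suc a₁) ∧ (x <ᵇ x)} (∨⁺ʳ {x ≡ᵇ a₁} (≡ᵇ⁺ {x} refl))
  ... | inj₁ a₁<x | inj₁ x<b = ∨⁺ˡ (∧⁺ (≮ᵇ⁺ a₁<x) (<ᵇ⁺ x<b))

  InB-outside : ∀ {z} → InB z → ¬ (z < a₁ ⊎ b < z)
  InB-outside (a₁≤z , _) (inj₁ z<a₁) = <⇒≱ z<a₁ a₁≤z
  InB-outside (_ , z≤b) (inj₂ b<z) = <⇒≱ b<z z≤b

  InQ : ℕ → ℕ → Set
  InQ x y = (x < suc a₁ × b ≤ y × y < suc c₁) ⊎ (suc a₁ ≤ x × x < b × suc c₁ ≤ y × y < suc m)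

  BQ⁻ : ∀ {x y} → BQ x y ≡ true → InQ x y
  BQ⁻ e with ∨⁻ e
  ... | inj₁ u = let (p , q) = ∧⁻ u ; (r , s) = ∧⁻ q in inj₁ (<ᵇ⁻ p , ≮ᵇ⁻ r , <ᵇ⁻ s)
  ... | inj₂ u = let (p , q) = ∧⁻ u ; (r , s) = ∧⁻ q ; (t , v) = ∧⁻ s
    in inj₂ (≮ᵇ⁻ p , <ᵇ⁻ r , ≮ᵇ⁻ t , <ᵇ⁻ v)

  BQ⁺ : ∀ {x y} → InQ x y → BQ x y ≡ true
  BQ⁺ (inj₁ (p , r , s)) = ∨⁺ˡ (∧⁺ (<ᵇ⁺ p) (∧⁺ (≮ᵇ⁺ r) (<ᵇ⁺ s)))
  BQ⁺ {x} {y} (inj₂ (p , r , s , t)) =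
    ∨⁺ʳ {(x <ᵇ suc a₁) ∧ not (y <ᵇ b) ∧ (y <ᵇ suc c₁)}
      (∧⁺ (≮ᵇ⁺ p) (∧⁺ (<ᵇ⁺ r) (∧⁺ (≮ᵇ⁺ s) (<ᵇ⁺ t))))

  BM⁻ : ∀ {x y} → BM x y ≡ true →
    (InQ x y × ¬ (x ≡ 0 × y ≡ c₁) × ¬ (x ≡ a₁ × y ≡ b)) ⊎ BT x y ≡ true ⊎ BB x y ≡ true
  BM⁻ e with ∨⁻ e
  ... | inj₁ u = let (p , q) = ∧⁻ u ; (r , s) = ∧⁻ q
    in inj₁ (BQ⁻ p , ¬singletonₑ⁻ {0} {c₁} r , ¬singletonₑ⁻ {a₁} {b} s)
  ... | inj₂ u = inj₂ (∨⁻ u)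

  BM⁺Q : ∀ {x y} → InQ x y → ¬ (x ≡ 0 × y ≡ c₁) → ¬ (x ≡ a₁ × y ≡ b) → BM x y ≡ true
  BM⁺Q q r s = ∨⁺ˡ (∧⁺ (BQ⁺ q) (∧⁺ (¬singletonₑ⁺ {0} {c₁} r) (¬singletonₑ⁺ {a₁} {b} s)))

  BM⁺T : ∀ {x y} → BT x y ≡ true → BM x y ≡ true
  BM⁺T {x} {y} t = ∨⁺ʳ {BQ x y ∧ not (singletonₑ 0 c₁ x y) ∧ not (singletonₑ a₁ b x y)} (∨⁺ˡ t)

  BM⁺B : ∀ {x y} → BB x y ≡ true → BM x y ≡ true
  BM⁺B {x} {y} t = ∨⁺ʳ {BQ x y ∧ not (singletonₑ 0 c₁ x y) ∧ not (singletonₑ a₁ b x y)} (∨⁺ʳ {BT x y} t)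

  WT-diagonal⁺ : ∀ {x y} → suc x < y → y ≤ m → (0 < x ⊎ y < m) → InT x → InT y → ¬ (x ≡ 0 × y ≡ c₁)
    → Diagonal WT x y
  WT-diagonal⁺ {x} {y} sx<y y≤m outside tx ty not-cut =
    <-trans (n<1+n x) sx<y , WT⁺ tx , WT⁺ ty , between (proj₁ tx) , beyond (proj₁ tx) outside
    where
    between : (x ≡ 0 ⊎ c₁ ≤ x) → ∃[ k ] (x < k × k < y × WT k ≡ true)
    between (inj₁ refl) with proj₁ ty
    ... | inj₁ refl = ⊥-elim (<⇒≱ sx<y z≤n)
    ... | inj₂ c₁≤y with m≤n⇒m<n∨m≡n c₁≤y
    ...   | inj₁ c₁<y = c₁ , 0<c₁ , c₁<y , WT⁺ (inj₂ ≤-refl , <⇒≤ c₁<m)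
    ...   | inj₂ refl = ⊥-elim (not-cut (refl , refl))
    between (inj₂ c₁≤x) =
      suc x , n<1+n x , sx<y , WT⁺ (inj₂ (≤-trans c₁≤x (n≤1+n x)) , ≤-trans (<⇒≤ sx<y) y≤m)
    beyond : (x ≡ 0 ⊎ c₁ ≤ x) → (0 < x ⊎ y < m) → ∃[ k ] ((k < x ⊎ y < k) × WT k ≡ true)
    beyond (inj₁ refl) (inj₁ ())
    beyond (inj₁ refl) (inj₂ y<m) = m , inj₂ y<m , WT⁺ (inj₂ (<⇒≤ c₁<m) , ≤-refl)
    beyond (inj₂ c₁≤x) _ = 0 , inj₁ (<-≤-trans 0<c₁ c₁≤x) , WT⁺ (inj₁ refl , z≤n)

  WT-diagonal⁻ : ∀ {x y} → Diagonal WT x y → InT x × InT y × ¬ (x ≡ 0 × y ≡ c₁)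
  WT-diagonal⁻ (_ , wx , wy , (k , x<k , k<y , wk) , _) =
    WT⁻ wx , WT⁻ wy , λ { (refl , refl) → InT-gap (WT⁻ wk) x<k k<y }

  WB-diagonal⁺ : ∀ {x y} → suc x < y → InB x → InB y → ¬ (x ≡ a₁ × y ≡ b) → Diagonal WB x y
  WB-diagonal⁺ {x} {y} sx<y (a₁≤x , x≤b) (a₁≤y , y≤b) not-cut =
    <-trans (n<1+n x) sx<y , WB⁺ (a₁≤x , x≤b) , WB⁺ (a₁≤y , y≤b)
    , (suc x , n<1+n x , sx<y , WB⁺ (≤-trans a₁≤x (n≤1+n x) , ≤-trans (<⇒≤ sx<y) y≤b))
    , beyond (m≤n⇒m<n∨m≡n a₁≤x)
    where
    beyond : (a₁ < x ⊎ a₁ ≡ x) → ∃[ k ] ((k < x ⊎ y < k) × WB k ≡ true)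
    beyond (inj₁ a₁<x) = a₁ , inj₁ a₁<x , WB⁺ (≤-refl , <⇒≤ a₁<b)
    beyond (inj₂ refl) with m≤n⇒m<n∨m≡n y≤b
    ... | inj₁ y<b = b , inj₂ y<b , WB⁺ (<⇒≤ a₁<b , ≤-refl)
    ... | inj₂ refl = ⊥-elim (not-cut (refl , refl))

  WB-diagonal⁻ : ∀ {x y} → Diagonal WB x y → InB x × InB y × ¬ (x ≡ a₁ × y ≡ b)
  WB-diagonal⁻ (_ , wx , wy , _ , (k , outside , wk)) =
    WB⁻ wx , WB⁻ wy , λ { (refl , refl) → InB-outside (WB⁻ wk) outside }

  WT≤m : ∀ z → WT z ≡ true → z ≤ m
  WT≤m z w = proj₂ (WT⁻ w)

  WB≤m : ∀ z → WB z ≡ true → z ≤ m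
  WB≤m z w = ≤-trans (proj₂ (WB⁻ w)) b≤m

  BT-diagonal : ∀ {x y} → BT x y ≡ true → Diagonal WT x y
  BT-diagonal {x} {y} = proj₁ (proj₁ satT) x y

  BB-diagonal : ∀ {x y} → BB x y ≡ true → Diagonal WB x y
  BB-diagonal {x} {y} = proj₁ (proj₁ satB) x y

  ∉BM : ∀ {x y} → (InQ x y → (x ≡ 0 × y ≡ c₁) ⊎ (x ≡ a₁ × y ≡ b))
    → (InT x → InT y → ⊥) → (InB x → InB y → ⊥)
    → ¬ BM x y ≡ true
  ∉BM q t d e with BM⁻ e
  ... | inj₁ (inQ , not-0c₁ , not-a₁b) = [ not-0c₁ , not-a₁b ]′ (q inQ)
  ... | inj₂ (inj₁ bt) = let (tx , ty , _) = WT-diagonal⁻ (BT-diagonal bt) in t tx ty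
  ... | inj₂ (inj₂ bb) = let (dx , dy , _) = WB-diagonal⁻ (BB-diagonal bb) in d dx dy

  BQ-diagonal : ∀ {x y} → InQ x y → Diagonal P x y
  BQ-diagonal (inj₁ (x<a , b≤y , y<c)) =
    diagonal⁺ (<-≤-trans (≤-<-trans x<a a<b) b≤y) (≤-trans (≤-pred y<c) (<⇒≤ c₁<m))
      (inj₂ (≤-<-trans (≤-pred y<c) c₁<m))
  BQ-diagonal (inj₂ (a≤x , x<b , c≤y , y<n)) =
    diagonal⁺ (<-≤-trans (s≤s x<b) (≤-trans (<⇒≤ (s≤s b<c₁)) c≤y)) (≤-pred y<n)
      (inj₁ (<-≤-trans (s≤s z≤n) a≤x))

  BM-diagonals : DiagonalSet P BM
  BM-diagonals x y e with BM⁻ e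
  ... | inj₁ (q , _ , _) = BQ-diagonal q
  ... | inj₂ (inj₁ t) = Diagonal-polygon WT≤m (BT-diagonal t)
  ... | inj₂ (inj₂ t) = Diagonal-polygon WB≤m (BB-diagonal t)

  -- Splitting off ears from a chord (i, j) from V_R to V_T: the apex lies in V_R or V_T
  -- (and a shorter such chord remains) unless it lies in V_B or V_L, giving an edge of B_Q.
  BQ-edge-below : ∀ {T} → Triangulation P T → ∀ fuel i j → j ≤ i + fuel → i < suc a₁ → suc c₁ ≤ j → j ≤ m
    → (∀ x y → T x y ≡ true → ¬ Cross i j x y) → ∃[ p ] ∃[ q ] (T p q ≡ true × InQ p q)
  BQ-edge-below tri zero i j j≤i i<a c≤j _ _ =
    ⊥-elim (<⇒≱ (<-≤-trans i<a (≤-trans (<⇒≤ (s≤s a₁<c₁)) c≤j)) (subst (j ≤_) (+-identityʳ i) j≤i))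
  BQ-edge-below {T} tri (suc fuel) i j j≤ i<a c≤j j≤m ok
    with ear tri (≤-trans (s≤s i<a) (≤-trans (s≤s a₁<c₁) c≤j)) j≤m ok
  ... | k , i<k , k<j , sik , skj with k <? suc a₁ | k <? b | k <? suc c₁
  ...   | yes k<a | _ | _ =
    BQ-edge-below tri fuel k j (≤-trans (subst (j ≤_) (+-suc i fuel) j≤) (+-monoˡ-≤ fuel i<k)) k<a c≤j j≤m
      (λ x y t → proj₁ (proj₂ tri) k j x y tkj t)
    where tkj : T k j ≡ true
          tkj = SideOr-gap {T} skj (<-≤-trans (s≤s k<a) (≤-trans (s≤s a₁<c₁) c≤j))
  ...   | no k≮a | yes k<b | _ =
    k , j , SideOr-gap {T} skj (<-≤-trans (s≤s k<b) (≤-trans (≤-trans b<c₁ (n≤1+n c₁)) c≤j))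
      , inj₂ (≮⇒≥ k≮a , k<b , c≤j , s≤s j≤m)
  ...   | no _ | no k≮b | yes k<c =
    i , k , SideOr-gap {T} sik (<-≤-trans (s≤s i<a) (≤-trans a<b (≮⇒≥ k≮b))) , inj₁ (i<a , ≮⇒≥ k≮b , k<c)
  ...   | no _ | no _ | no k≮c =
    BQ-edge-below tri fuel i k (≤-pred (<-≤-trans k<j (subst (j ≤_) (+-suc i fuel) j≤))) i<a (≮⇒≥ k≮c)
      (≤-trans (<⇒≤ k<j) j≤m) (λ x y t → proj₁ (proj₂ tri) i k x y tik t)
    where tik : T i k ≡ true
          tik = SideOr-gap {T} sik (<-≤-trans (s≤s i<a) (≤-trans (s≤s a₁<c₁) (≮⇒≥ k≮c)))

  BQ-edge : ∀ {T} → Triangulation P T → ∃[ p ] ∃[ q ] (T p q ≡ true × InQ p q)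
  BQ-edge {T} tri = BQ-edge-below tri m 0 m ≤-refl (s≤s z≤n) (<⇒≤ c<m) ≤-refl side-0m
    where
    side-0m : ∀ x y → T x y ≡ true → ¬ Cross 0 m x y
    side-0m x y t (inj₁ (_ , _ , m<y)) = <⇒≱ m<y (proj₁ (proj₂ (diagonal⁻ (proj₁ tri x y t))))
    side-0m x y t (inj₂ (() , _ , _))

  module Restriction {T : EdgeSet} (tri : Triangulation P T) where

    T∩WT : EdgeSet
    T∩WT x y = T x y ∧ WT x ∧ WT y ∧ not (singletonₑ 0 c₁ x y)

    T∩WT⁻ : ∀ {x y} → T∩WT x y ≡ true → T x y ≡ true × InT x × InT y × ¬ (x ≡ 0 × y ≡ c₁)
    T∩WT⁻ {x} {y} e = let (t , r) = ∧⁻ {T x y} e ; (wx , r') = ∧⁻ {WT x} r ; (wy , cut) = ∧⁻ {WT y} r'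
      in t , WT⁻ wx , WT⁻ wy , ¬singletonₑ⁻ {0} {c₁} cut

    T∩WT⁺ : ∀ {x y} → T x y ≡ true → InT x → InT y → ¬ (x ≡ 0 × y ≡ c₁) → T∩WT x y ≡ true
    T∩WT⁺ t tx ty cut = ∧⁺ t (∧⁺ (WT⁺ tx) (∧⁺ (WT⁺ ty) (¬singletonₑ⁺ {0} {c₁} cut)))

    -- An edge of T crossed by a diagonal of W-T cannot lie within [0, c₁] nor cross (0, c₁), so it is in T∩WT.
    T∩WT-triangulation : T 0 c₁ ≡ true → Triangulation WT T∩WT
    T∩WT-triangulation t0 =
      diagT∩WT , (λ x y z w e f → proj₁ (proj₂ tri) x y z w (proj₁ (T∩WT⁻ e)) (proj₁ (T∩WT⁻ f))) , maximal
      where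
      diagT∩WT : DiagonalSet WT T∩WT
      diagT∩WT x y e = let (t , tx , ty , cut) = T∩WT⁻ e ; (gap , y≤m , outside) = diagonal⁻ (proj₁ tri x y t)
        in WT-diagonal⁺ gap y≤m outside tx ty cut
      maximal : ∀ U → DiagonalSet WT U → NonCrossing U → T∩WT ⊆ₑ U → U ⊆ₑ T∩WT
      maximal U diagU ncU T∩WT⊆U p q upq = T∩WT⁺ (Triangulation-closed tri (Diagonal-polygon WT≤m dpq) ok) tp tq cut
        where
        dpq : Diagonal WT p q
        dpq = diagU p q upq
        tp : InT p
        tp = proj₁ (WT-diagonal⁻ dpq)
        tq : InT q
        tq = proj₁ (proj₂ (WT-diagonal⁻ dpq))
        cut : ¬ (p ≡ 0 × q ≡ c₁)
        cut = proj₂ (proj₂ (WT-diagonal⁻ dpq))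
        ok : ∀ x y → T x y ≡ true → ¬ Cross p q x y
        ok x y t with c₁ <? y
        ... | yes c₁<y = ncU p q x y upq (T∩WT⊆U x y (T∩WT⁺ t tx ty (λ { (_ , refl) → <-irrefl refl c₁<y })))
          where
          y≤m : y ≤ m
          y≤m = proj₁ (proj₂ (diagonal⁻ (proj₁ tri x y t)))
          ty : InT y
          ty = inj₂ (<⇒≤ c₁<y) , y≤m
          tx : InT x
          tx = [ id , (λ cr → ⊥-elim (proj₁ (proj₂ tri) 0 c₁ x y t0 t cr)) ]′
            (InT⊎Cross-cut (proj₁ (proj₁ tri x y t)) c₁<y y≤m)
        ... | no c₁≮y = λ
          { (inj₁ (p<x , x<q , q<y)) → InT-gap tq (≤-<-trans z≤n x<q) (<-≤-trans q<y (≮⇒≥ c₁≮y))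
          ; (inj₂ (x<p , p<y , y<q)) → InT-gap tp (≤-<-trans z≤n x<p) (<-≤-trans p<y (≮⇒≥ c₁≮y)) }

    T∩WB : EdgeSet
    T∩WB x y = T x y ∧ WB x ∧ WB y ∧ not (singletonₑ a₁ b x y)

    T∩WB⁻ : ∀ {x y} → T∩WB x y ≡ true → T x y ≡ true × InB x × InB y × ¬ (x ≡ a₁ × y ≡ b)
    T∩WB⁻ {x} {y} e = let (t , r) = ∧⁻ {T x y} e ; (wx , r') = ∧⁻ {WB x} r ; (wy , cut) = ∧⁻ {WB y} r'
      in t , WB⁻ wx , WB⁻ wy , ¬singletonₑ⁻ {a₁} {b} cut

    T∩WB⁺ : ∀ {x y} → T x y ≡ true → InB x → InB y → ¬ (x ≡ a₁ × y ≡ b) → T∩WB x y ≡ true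
    T∩WB⁺ t dx dy cut = ∧⁺ t (∧⁺ (WB⁺ dx) (∧⁺ (WB⁺ dy) (¬singletonₑ⁺ {a₁} {b} cut)))

    T∩WB-triangulation : T a₁ b ≡ true → Triangulation WB T∩WB
    T∩WB-triangulation tab =
      diagT∩WB , (λ x y z w e f → proj₁ (proj₂ tri) x y z w (proj₁ (T∩WB⁻ e)) (proj₁ (T∩WB⁻ f))) , maximal
      where
      diagT∩WB : DiagonalSet WB T∩WB
      diagT∩WB x y e = let (t , dx , dy , cut) = T∩WB⁻ e in WB-diagonal⁺ (proj₁ (diagonal⁻ (proj₁ tri x y t))) dx dy cut
      maximal : ∀ U → DiagonalSet WB U → NonCrossing U → T∩WB ⊆ₑ U → U ⊆ₑ T∩WB
      maximal U diagU ncU T∩WB⊆U p q upq = T∩WB⁺ (Triangulation-closed tri (Diagonal-polygon WB≤m dpq) ok) dp dq cut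
        where
        dpq : Diagonal WB p q
        dpq = diagU p q upq
        dp : InB p
        dp = proj₁ (WB-diagonal⁻ dpq)
        dq : InB q
        dq = proj₁ (proj₂ (WB-diagonal⁻ dpq))
        cut : ¬ (p ≡ a₁ × q ≡ b)
        cut = proj₂ (proj₂ (WB-diagonal⁻ dpq))
        ok : ∀ x y → T x y ≡ true → ¬ Cross p q x y
        ok x y t cr with Cross⇒inside⊎Cross (proj₁ dp) (proj₂ dq) cr
        ... | inj₂ cr′ = proj₁ (proj₂ tri) a₁ b x y tab t cr′
        ... | inj₁ (a₁≤x , y≤b) =
          ncU p q x y upq (T∩WB⊆U x y (T∩WB⁺ t (a₁≤x , ≤-trans (<⇒≤ x<y) y≤b) (≤-trans a₁≤x (<⇒≤ x<y) , y≤b) not-cut)) cr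
          where
          x<y : x < y
          x<y = proj₁ (proj₁ tri x y t)
          not-cut : ¬ (x ≡ a₁ × y ≡ b)
          not-cut (refl , refl) = proj₂ (¬Cross-nested (proj₁ dp) (proj₂ dq)) cr

  BM-blocker : Blocker P BM
  BM-blocker = BM-diagonals , λ T tri → hit tri (BQ-edge tri)
    where
    hit : ∀ {T} → Triangulation P T → ∃[ p ] ∃[ q ] (T p q ≡ true × InQ p q)
       → ∃[ i ] ∃[ j ] (BM i j ≡ true × T i j ≡ true)
    hit tri (p , q , t , inQ) with p ≟ 0 | q ≟ c₁ | p ≟ a₁ | q ≟ b
    ... | yes refl | yes refl | _ | _ =
      let (i , j , bt , tij) = proj₂ (proj₁ satT) _ (Restriction.T∩WT-triangulation tri t)
      in i , j , BM⁺T bt , proj₁ (Restriction.T∩WT⁻ tri tij)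
    ... | _ | _ | yes refl | yes refl =
      let (i , j , bb , tij) = proj₂ (proj₁ satB) _ (Restriction.T∩WB-triangulation tri t)
      in i , j , BM⁺B bb , proj₁ (Restriction.T∩WB⁻ tri tij)
    ... | yes refl | no q≢c₁ | _ | _ = p , q , BM⁺Q inQ (λ { (_ , e) → q≢c₁ e }) (λ { (e , _) → <-irrefl e 0<a₁ }) , t
    ... | no p≢0 | _ | no p≢a₁ | _ = p , q , BM⁺Q inQ (λ { (e , _) → p≢0 e }) (λ { (e , _) → p≢a₁ e }) , t
    ... | no p≢0 | _ | yes refl | no q≢b = p , q , BM⁺Q inQ (λ { (e , _) → p≢0 e }) (λ { (_ , e) → q≢b e }) , t

  ¬BM-R×RB : ∀ {x y} → x < a₁ → x < y → y < b → ¬ BM x y ≡ true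
  ¬BM-R×RB {x} {y} x<a₁ x<y y<b = ∉BM
    (λ { (inj₁ (_ , b≤y , _)) → ⊥-elim (<⇒≱ y<b b≤y)
       ; (inj₂ (a≤x , _)) → ⊥-elim (<⇒≱ (<-trans x<a₁ (n<1+n a₁)) a≤x) })
    (λ _ ty → InT-gap ty (≤-<-trans z≤n x<y) (<-trans y<b b<c₁))
    (λ dx _ → <⇒≱ x<a₁ (proj₁ dx))

  ¬BM-R×T : ∀ {x y} → 0 < x → x ≤ a₁ → c₁ < y → ¬ BM x y ≡ true
  ¬BM-R×T {x} {y} 0<x x≤a₁ c₁<y = ∉BM
    (λ { (inj₁ (_ , _ , y<c)) → ⊥-elim (<⇒≱ c₁<y (≤-pred y<c))
       ; (inj₂ (a≤x , _)) → ⊥-elim (<⇒≱ (s≤s x≤a₁) a≤x) })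
    (λ tx _ → InT-gap tx 0<x (≤-<-trans x≤a₁ a₁<c₁))
    (λ _ dy → <⇒≱ (<-trans b<c₁ c₁<y) (proj₂ dy))

  ¬BM-BL×L : ∀ {x y} → a₁ < x → x < y → b < y → y ≤ c₁ → ¬ BM x y ≡ true
  ¬BM-BL×L {x} {y} a₁<x x<y b<y y≤c₁ = ∉BM
    (λ { (inj₁ (x<a , _)) → ⊥-elim (<⇒≱ a₁<x (≤-pred x<a))
       ; (inj₂ (_ , _ , c≤y , _)) → ⊥-elim (<⇒≱ (s≤s y≤c₁) c≤y) })
    (λ tx _ → InT-gap tx (≤-<-trans z≤n a₁<x) (<-≤-trans x<y y≤c₁))
    (λ _ dy → <⇒≱ b<y (proj₂ dy))

  ¬BM-L×LT : ∀ {x y} → b ≤ x → x < c₁ → x < y → ¬ BM x y ≡ true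
  ¬BM-L×LT {x} {y} b≤x x<c₁ x<y = ∉BM
    (λ { (inj₁ (x<a , _)) → ⊥-elim (<⇒≱ (<-≤-trans x<a (<⇒≤ a<b)) b≤x)
       ; (inj₂ (_ , x<b , _)) → ⊥-elim (<⇒≱ x<b b≤x) })
    (λ tx _ → InT-gap tx (<-≤-trans 0<b b≤x) x<c₁)
    (λ _ dy → <⇒≱ (<-≤-trans x<y (proj₂ dy)) b≤x)

  ¬BM-0c₁ : ¬ BM 0 c₁ ≡ true
  ¬BM-0c₁ e with BM⁻ e
  ... | inj₁ (_ , not-0c₁ , _) = not-0c₁ (refl , refl)
  ... | inj₂ (inj₁ bt) = proj₂ (proj₂ (WT-diagonal⁻ (BT-diagonal bt))) (refl , refl)
  ... | inj₂ (inj₂ bb) = <⇒≱ 0<a₁ (proj₁ (proj₁ (WB-diagonal⁻ (BB-diagonal bb))))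

  ¬BM-a₁b : ¬ BM a₁ b ≡ true
  ¬BM-a₁b e with BM⁻ e
  ... | inj₁ (_ , _ , not-a₁b) = not-a₁b (refl , refl)
  ... | inj₂ (inj₁ bt) = InT-gap (proj₁ (WT-diagonal⁻ (BT-diagonal bt))) 0<a₁ a₁<c₁
  ... | inj₂ (inj₂ bb) = proj₂ (proj₂ (WB-diagonal⁻ (BB-diagonal bb))) (refl , refl)

  Avoiding : ℕ → ℕ → ℕ → ℕ → Set
  Avoiding i j x y = (x ≡ i × y ≡ j) ⊎ ¬ BM x y ≡ true

  ¬Blocker-remove : ∀ {i j} (t : Tree 0 m) → AllDiagonals (Avoiding i j) t → ¬ Blocker P (remove BM i j)
  ¬Blocker-remove {i} {j} t avoid (_ , hits) with hits (diagonals t) (diagonals-triangulation t)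
  ... | x , y , r , d with avoid x y d | remove⁻ {BM} {i} {j} r
  ...   | inj₁ xy≡ij | _ , xy≢ij = xy≢ij xy≡ij
  ...   | inj₂ ∉BM | ∈BM , _ = ∉BM ∈BM

  RL-core : ∀ {i j} → i ≤ a₁ → b ≤ j → j ≤ c₁ → ¬ (i ≡ a₁ × j ≡ b) → Σ (Tree i j) (AllEdges (Avoiding i j))
  RL-core {i} {j} i≤a₁ b≤j j≤c₁ not-a₁b with i ≟ a₁
  ... | yes refl =
    node (suc a₁) (side a₁) (fanTo a<j)
    , AllEdges-node (side a₁) (fanTo a<j) (AllEdges-side a₁)
        (AllEdges-fanTo a<j (λ x a≤x sx<j → inj₂ (¬BM-BL×L a≤x (<-trans (n<1+n x) sx<j) b<j j≤c₁)))
        (inj₁ (refl , refl))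
    where
    a<j : suc a₁ < j
    a<j = <-≤-trans a<b b≤j
    b<j : b < j
    b<j = ≤∧≢⇒< b≤j (λ b≡j → not-a₁b (refl , sym b≡j))
  ... | no i≢a₁ =
    node b₁ (fanFrom i<b₁) (fanTo b₁<j)
    , AllEdges-node (fanFrom i<b₁) (fanTo b₁<j)
        (AllEdges-fanFrom i<b₁ (λ y si<y y≤b₁ → inj₂ (¬BM-R×RB i<a₁ (<-trans (n<1+n i) si<y) (s≤s y≤b₁))))
        (AllEdges-fanTo b₁<j (λ x b₁≤x sx<j →
          inj₂ (¬BM-BL×L (<-≤-trans a₁<b₁ b₁≤x) (<-trans (n<1+n x) sx<j) (≤-<-trans (s≤s b₁≤x) sx<j) j≤c₁)))
        (inj₁ (refl , refl))
    where
    i<a₁ : i < a₁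
    i<a₁ = ≤∧≢⇒< i≤a₁ i≢a₁
    a₁<b₁ : a₁ < b₁
    a₁<b₁ = <-trans (n<1+n a₁) a<b₁
    i<b₁ : i < b₁
    i<b₁ = <-trans i<a₁ a₁<b₁
    b₁<j : b₁ < j
    b₁<j = <-≤-trans b₁<b b≤j

  R×R-fan : ∀ {i j} (0<i : 0 < i) → i ≤ a₁ → AllEdges (Avoiding i j) (fanFrom 0<i)
  R×R-fan 0<i i≤a₁ = AllEdges-fanFrom 0<i (λ y 1<y y≤i →
    inj₂ (¬BM-R×RB 0<a₁ (<-trans (s≤s z≤n) 1<y) (≤-<-trans y≤i (≤-<-trans i≤a₁ a₁<b))))

  L×LT-fan : ∀ {i j} (j<m : j < m) → b ≤ j → j < c₁ → AllEdges (Avoiding i j) (fanFrom j<m)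
  L×LT-fan {j = j} j<m b≤j j<c₁ =
    AllEdges-fanFrom j<m (λ y sj<y _ → inj₂ (¬BM-L×LT b≤j j<c₁ (<-trans (n<1+n j) sj<y)))

  ¬Blocker-remove-R×L : ∀ {i j} → i ≤ a₁ → b ≤ j → j ≤ c₁ → ¬ (i ≡ 0 × j ≡ c₁) → ¬ (i ≡ a₁ × j ≡ b)
    → ¬ Blocker P (remove BM i j)
  ¬Blocker-remove-R×L {i} {j} i≤a₁ b≤j j≤c₁ not-0c₁ not-a₁b
    with RL-core i≤a₁ b≤j j≤c₁ not-a₁b | j <? c₁ | i ≟ 0
  ... | core , avoid | yes j<c₁ | yes refl =
    ¬Blocker-remove (node j core (fanFrom j<m))
      (AllDiagonals-node core (fanFrom j<m) avoid (L×LT-fan j<m b≤j j<c₁))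
    where
    j<m : j < m
    j<m = <-trans j<c₁ c₁<m
  ... | core , avoid | yes j<c₁ | no i≢0 =
    ¬Blocker-remove (node i (fanFrom 0<i) (node j core (fanFrom j<m)))
      (AllDiagonals-node (fanFrom 0<i) (node j core (fanFrom j<m)) (R×R-fan 0<i i≤a₁)
        (AllEdges-node core (fanFrom j<m) avoid (L×LT-fan j<m b≤j j<c₁) (inj₂ (¬BM-R×T 0<i i≤a₁ c₁<m))))
    where
    j<m : j < m
    j<m = <-trans j<c₁ c₁<m
    0<i : 0 < i
    0<i = n≢0⇒n>0 i≢0
  ... | core , avoid | no j≮c₁ | _ =
    ¬Blocker-remove (node i (fanFrom 0<i) (extend (node j core (side j)) sj≤′m))
      (AllDiagonals-node (fanFrom 0<i) (extend (node j core (side j)) sj≤′m) (R×R-fan 0<i i≤a₁)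
        (AllEdges-extend (node j core (side j)) sj≤′m
          (AllEdges-node core (side j) avoid (AllEdges-side j) (inj₂ (¬BM-R×T 0<i i≤a₁ (s≤s c₁≤j))))
          (λ y sj<y _ → inj₂ (¬BM-R×T 0<i i≤a₁ (≤-<-trans c₁≤j (<-trans (n<1+n j) sj<y))))))
    where
    c₁≤j : c₁ ≤ j
    c₁≤j = ≮⇒≥ j≮c₁
    0<i : 0 < i
    0<i = n≢0⇒n>0 (λ i≡0 → not-0c₁ (i≡0 , ≤-antisym j≤c₁ c₁≤j))
    sj≤′m : suc j ≤′ m
    sj≤′m = ≤⇒≤′ (≤-<-trans j≤c₁ c₁<m)

  ¬Blocker-remove-B×T : ∀ {i j} → a₁ < i → i < b → c₁ < j → j ≤ m → ¬ Blocker P (remove BM i j)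
  ¬Blocker-remove-B×T {i} {j} a₁<i i<b c₁<j j≤m =
    ¬Blocker-remove (node 1 (side 0) (extend base (≤⇒≤′ j≤m)))
      (AllDiagonals-node (side 0) (extend base (≤⇒≤′ j≤m)) (AllEdges-side 0)
        (AllEdges-extend base (≤⇒≤′ j≤m) avoid-base
          (λ y j<y _ → inj₂ (¬BM-R×T (s≤s z≤n) (<⇒≤ 1<a₁) (<-trans c₁<j j<y)))))
    where
    sb<c₁ : suc b < c₁
    sb<c₁ = b+2≤c₁
    1<i : 1 < i
    1<i = <-trans 1<a₁ a₁<i
    i<sb : i < suc b
    i<sb = <-trans i<b (n<1+n b)
    sb<j : suc b < j
    sb<j = <-trans sb<c₁ c₁<j
    core : Tree i j
    core = node (suc b) (fanTo i<sb) (fanFrom sb<j)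
    avoid-core : AllEdges (Avoiding i j) core
    avoid-core = AllEdges-node (fanTo i<sb) (fanFrom sb<j)
      (AllEdges-fanTo i<sb (λ x i≤x sx<sb →
        inj₂ (¬BM-BL×L (<-≤-trans a₁<i i≤x) (<-trans (n<1+n x) sx<sb) (n<1+n b) (<⇒≤ sb<c₁))))
      (AllEdges-fanFrom sb<j (λ y ssb<y _ → inj₂ (¬BM-L×LT (n≤1+n b) sb<c₁ (<-trans (n<1+n (suc b)) ssb<y))))
      (inj₁ (refl , refl))
    base : Tree 1 j
    base = node i (fanFrom 1<i) core
    avoid-base : AllEdges (Avoiding i j) base
    avoid-base = AllEdges-node (fanFrom 1<i) core
      (AllEdges-fanFrom 1<i (λ y 2<y y≤i → inj₂ (¬BM-R×RB 1<a₁ (<-trans (n<1+n 1) 2<y) (≤-<-trans y≤i i<b))))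
      avoid-core (inj₂ (¬BM-R×T (s≤s z≤n) (<⇒≤ 1<a₁) c₁<j))

  InT∩InB : ∀ {x} → InT x → InB x → ⊥
  InT∩InB (inj₁ refl , _) (a₁≤0 , _) = <⇒≱ 0<a₁ a₁≤0
  InT∩InB (inj₂ c₁≤x , _) (_ , x≤b) = <⇒≱ b<c₁ (≤-trans c₁≤x x≤b)

  InQ∩InT : ∀ {x y} → InQ x y → InT x → InT y → ¬ (x ≡ 0 × y ≡ c₁) → ⊥
  InQ∩InT (inj₁ (x<a , _)) (inj₂ c₁≤x , _) _ _ = <⇒≱ (≤-<-trans (≤-pred x<a) a₁<c₁) c₁≤x
  InQ∩InT (inj₁ (_ , b≤y , _)) (inj₁ refl , _) (inj₁ refl , _) _ = <⇒≱ 0<b b≤y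
  InQ∩InT (inj₁ (_ , _ , y<c)) (inj₁ refl , _) (inj₂ c₁≤y , _) not-0c₁ =
    not-0c₁ (refl , ≤-antisym (≤-pred y<c) c₁≤y)
  InQ∩InT (inj₂ (a≤x , _)) (inj₁ refl , _) _ _ = <⇒≱ (s≤s z≤n) a≤x
  InQ∩InT (inj₂ (_ , x<b , _)) (inj₂ c₁≤x , _) _ _ = <⇒≱ (<-trans x<b b<c₁) c₁≤x

  InQ∩InB : ∀ {x y} → InQ x y → InB x → InB y → ¬ (x ≡ a₁ × y ≡ b) → ⊥
  InQ∩InB (inj₁ (x<a , b≤y , _)) dx dy not-a₁b =
    not-a₁b (≤-antisym (≤-pred x<a) (proj₁ dx) , ≤-antisym (proj₂ dy) b≤y)
  InQ∩InB (inj₂ (_ , _ , c≤y , _)) _ dy _ = <⇒≱ (<-trans b<c₁ (n<1+n c₁)) (≤-trans c≤y (proj₂ dy))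

  BM∩WT⇒BT : ∀ {x y} → BM x y ≡ true → InT x → InT y → ¬ (x ≡ 0 × y ≡ c₁) → BT x y ≡ true
  BM∩WT⇒BT e tx ty not-0c₁ with BM⁻ e
  ... | inj₁ (inQ , _) = ⊥-elim (InQ∩InT inQ tx ty not-0c₁)
  ... | inj₂ (inj₁ bt) = bt
  ... | inj₂ (inj₂ bb) = ⊥-elim (InT∩InB tx (proj₁ (WB-diagonal⁻ (BB-diagonal bb))))

  BM∩WB⇒BB : ∀ {x y} → BM x y ≡ true → InB x → InB y → ¬ (x ≡ a₁ × y ≡ b) → BB x y ≡ true
  BM∩WB⇒BB e dx dy not-a₁b with BM⁻ e
  ... | inj₁ (inQ , _) = ⊥-elim (InQ∩InB inQ dx dy not-a₁b)
  ... | inj₂ (inj₁ bt) = ⊥-elim (InT∩InB (proj₁ (WT-diagonal⁻ (BT-diagonal bt))) dx)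
  ... | inj₂ (inj₂ bb) = bb

  ¬Cross-InT : ∀ {x y z w} → InT x → InT y → w ≤ c₁ → ¬ Cross x y z w × ¬ Cross z w x y
  ¬Cross-InT tx ty w≤c₁ =
    (λ { (inj₁ (x<z , z<y , y<w)) → InT-gap ty (≤-<-trans z≤n z<y) (<-≤-trans y<w w≤c₁)
       ; (inj₂ (z<x , x<w , w<y)) → InT-gap tx (≤-<-trans z≤n z<x) (<-≤-trans x<w w≤c₁) })
    , (λ { (inj₁ (z<x , x<w , w<y)) → InT-gap tx (≤-<-trans z≤n z<x) (<-≤-trans x<w w≤c₁)
         ; (inj₂ (x<z , z<y , y<w)) → InT-gap ty (≤-<-trans z≤n z<y) (<-≤-trans y<w w≤c₁) })

  lower : Tree 0 c₁
  lower = node (suc a₁) (fanFrom (s≤s z≤n)) (fanTo a<c₁)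

  lower-avoids : AllEdges (λ x y → ¬ BM x y ≡ true) lower
  lower-avoids = AllEdges-node (fanFrom (s≤s z≤n)) (fanTo a<c₁)
    (AllEdges-fanFrom (s≤s z≤n) (λ y 1<y y≤a → ¬BM-R×RB 0<a₁ (<-trans (s≤s z≤n) 1<y) (≤-<-trans y≤a a<b)))
    (AllEdges-fanTo a<c₁ (λ x a≤x sx<c₁ → ¬BM-BL×L a≤x (<-trans (n<1+n x) sx<c₁) b<c₁ ≤-refl))
    ¬BM-0c₁

  module GlueLower {T′ : EdgeSet} (tri′ : Triangulation WT T′) where

    S : EdgeSet
    S = T′ ∪ₑ edges lower

    T′⊆S : T′ ⊆ₑ S
    T′⊆S x y = ∪ₑ⁺ˡ {T′} {edges lower}

    lower⊆S : edges lower ⊆ₑ S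
    lower⊆S x y = ∪ₑ⁺ʳ {T′} {edges lower}

    S-diagonals : DiagonalSet P S
    S-diagonals = DiagonalSet-∪ₑ {A = T′} {edges lower} (λ x y t → Diagonal-polygon WT≤m (proj₁ tri′ x y t))
      (DiagonalSet-edges lower (<⇒≤ c₁<m) (inj₂ c₁<m))

    S-nonCrossing : NonCrossing S
    S-nonCrossing = NonCrossing-∪ₑ {T′} {edges lower} (proj₁ (proj₂ tri′)) (edges-nonCrossing lower) λ x y z w t l →
      let (tx , ty , _) = WT-diagonal⁻ (proj₁ tri′ x y t) in ¬Cross-InT tx ty (proj₂ (proj₂ (edges-bounds lower l)))

    S-0c₁ : S 0 c₁ ≡ true
    S-0c₁ = lower⊆S 0 c₁ (edges-root (fanFrom (s≤s z≤n)) (fanTo a<c₁))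

    S-complete-lower : Complete S 0 c₁
    S-complete-lower = Complete-mono lower⊆S (Complete-edges lower)

    S-complete : Complete S 0 m
    S-complete p q _ q≤m gap inner nc with q ≤? c₁ | p ≟ 0 | q ≟ c₁
    ... | yes q≤c₁ | yes refl | yes refl = S-0c₁
    ... | yes q≤c₁ | yes refl | no q≢c₁ = S-complete-lower p q z≤n q≤c₁ gap (inj₂ (≤∧≢⇒< q≤c₁ q≢c₁)) nc
    ... | yes q≤c₁ | no p≢0 | _ = S-complete-lower p q z≤n q≤c₁ gap (inj₁ (n≢0⇒n>0 p≢0)) nc
    ... | no q≰c₁ | _ | _ =
      T′⊆S p q (Triangulation-closed tri′ (WT-diagonal⁺ gap q≤m inner tp tq not-0c₁) (λ x y t → nc x y (T′⊆S x y t)))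
      where
      tq : InT q
      tq = inj₂ (<⇒≤ (≰⇒> q≰c₁)) , q≤m
      not-0c₁ : ¬ (p ≡ 0 × q ≡ c₁)
      not-0c₁ (_ , refl) = q≰c₁ ≤-refl
      tp : InT p
      tp = [ id , (λ cr → ⊥-elim (nc 0 c₁ S-0c₁ (Cross-sym cr))) ]′
        (InT⊎Cross-cut (<-trans (n<1+n p) gap) (≰⇒> q≰c₁) q≤m)

    S-triangulation : Triangulation P S
    S-triangulation = Complete⇒Triangulation S S-diagonals S-nonCrossing S-complete

  ¬Blocker-remove-BT : ∀ {i j} → BT i j ≡ true → ¬ Blocker P (remove BM i j)
  ¬Blocker-remove-BT {i} {j} bt (_ , hits) = proj₂ satT i j bt (diagonals′ , hits′)
    where
    diagonals′ : DiagonalSet WT (remove BT i j)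
    diagonals′ x y r = BT-diagonal (proj₁ (remove⁻ {BT} {i} {j} r))
    hits′ : ∀ T′ → Triangulation WT T′ → ∃[ x ] ∃[ y ] (remove BT i j x y ≡ true × T′ x y ≡ true)
    hits′ T′ tri′ with hits _ (GlueLower.S-triangulation tri′)
    ... | x , y , r , s with remove⁻ {BM} {i} {j} r | ∪ₑ⁻ {T′} {edges lower} s
    ...   | bm , _ | inj₂ l = ⊥-elim (lower-avoids x y l bm)
    ...   | bm , not-ij | inj₁ t =
      let (tx , ty , not-0c₁) = WT-diagonal⁻ (proj₁ tri′ x y t)
      in x , y , remove⁺ {BT} {i} {j} (BM∩WT⇒BT bm tx ty not-0c₁) not-ij , t

  left : Tree 0 a₁
  left = fanTo 0<a₁

  left-avoids : AllEdges (λ x y → ¬ BM x y ≡ true) left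
  left-avoids = AllEdges-fanTo 0<a₁ (λ x _ sx<a₁ → ¬BM-R×RB (<-trans (n<1+n x) sx<a₁) (<-trans (n<1+n x) sx<a₁) a₁<b)

  right : Tree b m
  right = fanFrom b<m

  right-avoids : AllEdges (λ x y → ¬ BM x y ≡ true) right
  right-avoids = AllEdges-fanFrom b<m (λ y sb<y _ → ¬BM-L×LT ≤-refl b<c₁ (<-trans (n<1+n b) sb<y))

  module GlueOuter {T′ : EdgeSet} (tri′ : Triangulation WB T′) where

    inner middle upper S : EdgeSet
    inner = T′ ∪ₑ singletonₑ a₁ b
    middle = inner ∪ₑ edges right
    upper = middle ∪ₑ singletonₑ a₁ m
    S = edges left ∪ₑ upper

    upper⊆S : upper ⊆ₑ S
    upper⊆S x y = ∪ₑ⁺ʳ {edges left} {upper}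

    middle⊆S : middle ⊆ₑ S
    middle⊆S x y e = upper⊆S x y (∪ₑ⁺ˡ {middle} {singletonₑ a₁ m} e)

    inner⊆S : inner ⊆ₑ S
    inner⊆S x y e = middle⊆S x y (∪ₑ⁺ˡ {inner} {edges right} e)

    T′⊆S : T′ ⊆ₑ S
    T′⊆S x y t = inner⊆S x y (∪ₑ⁺ˡ {T′} {singletonₑ a₁ b} t)

    left⊆S : edges left ⊆ₑ S
    left⊆S x y = ∪ₑ⁺ˡ {edges left} {upper}

    right⊆S : edges right ⊆ₑ S
    right⊆S x y e = middle⊆S x y (∪ₑ⁺ʳ {inner} {edges right} e)

    S-a₁b : S a₁ b ≡ true
    S-a₁b = inner⊆S a₁ b (∪ₑ⁺ʳ {T′} {singletonₑ a₁ b} (singletonₑ⁺ {a₁} {b}))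

    S-a₁m : S a₁ m ≡ true
    S-a₁m = upper⊆S a₁ m (∪ₑ⁺ʳ {middle} {singletonₑ a₁ m} (singletonₑ⁺ {a₁} {m}))

    S⁻ : ∀ {x y} → S x y ≡ true → T′ x y ≡ true ⊎ ¬ BM x y ≡ true
    S⁻ {x} {y} e with ∪ₑ⁻ {edges left} {upper} e
    ... | inj₁ l = inj₂ (left-avoids x y l)
    ... | inj₂ u with ∪ₑ⁻ {middle} {singletonₑ a₁ m} u
    ...   | inj₂ am with singletonₑ⁻ {a₁} {m} {x} {y} am
    ...     | refl , refl = inj₂ (¬BM-R×T 0<a₁ ≤-refl c₁<m)
    S⁻ {x} {y} e | inj₂ u | inj₁ md with ∪ₑ⁻ {inner} {edges right} md
    ...   | inj₂ r = inj₂ (right-avoids x y r)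
    ...   | inj₁ i with ∪ₑ⁻ {T′} {singletonₑ a₁ b} i
    ...     | inj₁ t = inj₁ t
    ...     | inj₂ ab with singletonₑ⁻ {a₁} {b} {x} {y} ab
    ...       | refl , refl = inj₂ ¬BM-a₁b

    T′-within : Within T′ a₁ b
    T′-within x y t =
      let (dx , dy , _) = WB-diagonal⁻ (proj₁ tri′ x y t) in proj₁ dx , proj₁ (proj₁ tri′ x y t) , proj₂ dy

    inner-within : Within inner a₁ b
    inner-within = Within-∪ₑ {T′} T′-within (Within-singletonₑ a₁<b)

    middle-within : Within middle a₁ m
    middle-within = Within-∪ₑ {inner} (Within-widen ≤-refl b≤m inner-within)
      (Within-widen (<⇒≤ a₁<b) ≤-refl (Within-edges right))

    S-nonCrossing : NonCrossing S
    S-nonCrossing = NonCrossing-∪ₑ-apart {edges left} {upper} (edges-nonCrossing left)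
      (NonCrossing-∪ₑ-around {middle}
        (NonCrossing-∪ₑ-apart {inner} {edges right}
          (NonCrossing-∪ₑ-around {T′} (proj₁ (proj₂ tri′)) T′-within) (edges-nonCrossing right)
          inner-within (Within-edges right))
        middle-within)
      (Within-edges left) (Within-∪ₑ {middle} middle-within (Within-singletonₑ a₁<m))

    S-diagonals : DiagonalSet P S
    S-diagonals = DiagonalSet-∪ₑ {A = edges left} {upper} (DiagonalSet-edges left (<⇒≤ a₁<m) (inj₂ a₁<m))
      (DiagonalSet-∪ₑ {A = middle}
        (DiagonalSet-∪ₑ {A = inner}
          (DiagonalSet-∪ₑ {A = T′} (λ x y t → Diagonal-polygon WB≤m (proj₁ tri′ x y t))
            (DiagonalSet-singletonₑ (diagonal⁺ a<b b≤m (inj₁ 0<a₁))))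
          (DiagonalSet-edges right ≤-refl (inj₁ 0<b)))
        (DiagonalSet-singletonₑ (diagonal⁺ (<-trans a<b b<m) ≤-refl (inj₁ 0<a₁))))

    S-complete-inner : Complete S a₁ b
    S-complete-inner p q a₁≤p q≤b gap interior nc =
      T′⊆S p q (Triangulation-closed tri′ (WB-diagonal⁺ gap (a₁≤p , ≤-trans p≤q q≤b) (≤-trans a₁≤p p≤q , q≤b) not-cut)
        (λ x y t → nc x y (T′⊆S x y t)))
      where
      p≤q : p ≤ q
      p≤q = <⇒≤ (<-trans (n<1+n p) gap)
      not-cut : ¬ (p ≡ a₁ × q ≡ b)
      not-cut (refl , refl) = [ <-irrefl refl , <-irrefl refl ]′ interior

    S-complete : Complete S 0 m
    S-complete = Complete-glue 0<a₁ a₁<m (inj₂ (left⊆S 0 a₁ (edges-base left 1<a₁))) (inj₂ S-a₁m)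
      (Complete-mono left⊆S (Complete-edges left))
      (Complete-glue a₁<b b<m (inj₂ S-a₁b) (inj₂ (right⊆S b m (edges-base right (<-trans b+2≤c₁ c₁<m))))
        S-complete-inner (Complete-mono right⊆S (Complete-edges right)))

    S-triangulation : Triangulation P S
    S-triangulation = Complete⇒Triangulation S S-diagonals S-nonCrossing S-complete

  ¬Blocker-remove-BB : ∀ {i j} → BB i j ≡ true → ¬ Blocker P (remove BM i j)
  ¬Blocker-remove-BB {i} {j} bb (_ , hits) = proj₂ satB i j bb (diagonals′ , hits′)
    where
    diagonals′ : DiagonalSet WB (remove BB i j)
    diagonals′ x y r = BB-diagonal (proj₁ (remove⁻ {BB} {i} {j} r))
    hits′ : ∀ T′ → Triangulation WB T′ → ∃[ x ] ∃[ y ] (remove BB i j x y ≡ true × T′ x y ≡ true)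
    hits′ T′ tri′ with hits _ (GlueOuter.S-triangulation tri′)
    ... | x , y , r , s with remove⁻ {BM} {i} {j} r | GlueOuter.S⁻ tri′ s
    ...   | bm , _ | inj₂ ∉BM = ⊥-elim (∉BM bm)
    ...   | bm , not-ij | inj₁ t =
      let (dx , dy , not-a₁b) = WB-diagonal⁻ (proj₁ tri′ x y t)
      in x , y , remove⁺ {BB} {i} {j} (BM∩WB⇒BB bm dx dy not-a₁b) not-ij , t

  BM-saturated : SaturatedBlocker P BM
  BM-saturated = BM-blocker , saturation
    where
    saturation : ∀ i j → BM i j ≡ true → ¬ Blocker P (remove BM i j)
    saturation i j e with BM⁻ e
    ... | inj₁ (inj₁ (i<a , b≤j , j<c) , not-0c₁ , not-a₁b) =
      ¬Blocker-remove-R×L (≤-pred i<a) b≤j (≤-pred j<c) not-0c₁ not-a₁b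
    ... | inj₁ (inj₂ (a≤i , i<b , c≤j , j<n) , _ , _) = ¬Blocker-remove-B×T a≤i i<b c≤j (≤-pred j<n)
    ... | inj₂ (inj₁ bt) = ¬Blocker-remove-BT bt
    ... | inj₂ (inj₂ bb) = ¬Blocker-remove-BB bb

  BQ-size : size (suc m) BQ ≡ (suc m ∸ suc c₁) * (b ∸ suc a₁) + (suc c₁ ∸ b) * suc a₁
  BQ-size = begin
    size n BQ
      ≡⟨ size-cong n (λ x y → cong (R×L x y ∨_) (sym (∧-assoc (not (x <ᵇ a)) (x <ᵇ b) (range c n y)))) ⟩
    size n (R×L ∪ₑ B×T)
      ≡⟨ size-∪ₑ n R×L∩B×T ⟩
    size n R×L + size n B×T
      ≡⟨ cong₂ _+_ (size-× n (_<ᵇ a) (range b c) (λ _ → <ᵇ⁻) (λ y r → ≤-trans (<⇒≤ a<b) (≮ᵇ⁻ (proj₁ (∧⁻ r)))))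
                   (size-× n (λ x → not (x <ᵇ a) ∧ (x <ᵇ b)) (range c n) (λ _ r → <ᵇ⁻ (proj₂ (∧⁻ r)))
                      (λ y r → ≤-trans (<⇒≤ (<-trans b<c₁ (n<1+n c₁))) (≮ᵇ⁻ (proj₁ (∧⁻ r))))) ⟩
    ∑< a (λ x → ind (x <ᵇ a)) * ∑< n (ind ∘ range b c) + ∑< b (ind ∘ range a b) * ∑< n (ind ∘ range c n)
      ≡⟨ cong₂ _+_ (cong₂ _*_ (∑<-<ᵇ a ≤-refl) (∑<-range n (<⇒≤ (<-trans b<c₁ (n<1+n c₁))) (s≤s (<⇒≤ c₁<m))))
                   (cong₂ _*_ (∑<-range b (<⇒≤ a<b) ≤-refl) (∑<-range n (s≤s (<⇒≤ c₁<m)) ≤-refl)) ⟩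
    a * (c ∸ b) + (b ∸ a) * (n ∸ c)
      ≡⟨ trans (+-comm (a * (c ∸ b)) ((b ∸ a) * (n ∸ c))) (cong₂ _+_ (*-comm (b ∸ a) (n ∸ c)) (*-comm a (c ∸ b))) ⟩
    (n ∸ c) * (b ∸ a) + (c ∸ b) * a ∎
    where
    open ≡-Reasoning
    n a c : ℕ
    n = suc m
    a = suc a₁
    c = suc c₁
    range : ℕ → ℕ → ℕ → Bool
    range l h x = not (x <ᵇ l) ∧ (x <ᵇ h)
    R×L B×T : EdgeSet
    R×L x y = (x <ᵇ a) ∧ range b c y
    B×T x y = (not (x <ᵇ a) ∧ (x <ᵇ b)) ∧ range c n y
    R×L∩B×T : ∀ x y → ¬ (R×L x y ≡ true × B×T x y ≡ true)
    R×L∩B×T x y (rl , bt) =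
      not⁻ {x <ᵇ a} (proj₁ (∧⁻ {not (x <ᵇ a)} (proj₁ (∧⁻ {not (x <ᵇ a) ∧ (x <ᵇ b)} bt))))
        (proj₁ (∧⁻ {x <ᵇ a} rl))

  -- B_M is B_Q minus the two cuts, disjointly united with B_T and B_B.
  BM-size : size (suc m) BM + 2 ≡ size (suc m) BQ + size (suc m) BT + size (suc m) BB
  BM-size = begin
    size n BM + 2
      ≡⟨ cong (_+ 2) (size-cong n (λ x y → cong (_∨ (BT x y ∨ BB x y)) (sym (∧-assoc (BQ x y) _ _)))) ⟩
    size n (BQ₂ ∪ₑ (BT ∪ₑ BB)) + 2
      ≡⟨ cong (_+ 2) (trans (size-∪ₑ n BQ₂∩BTB) (cong (size n BQ₂ +_) (size-∪ₑ n BT∩BB))) ⟩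
    size n BQ₂ + (size n BT + size n BB) + 2
      ≡⟨ solve 3 (λ q t d → q :+ (t :+ d) :+ con 2 := q :+ con 1 :+ con 1 :+ t :+ d) refl
           (size n BQ₂) (size n BT) (size n BB) ⟩
    size n BQ₂ + 1 + 1 + size n BT + size n BB
      ≡⟨ cong (λ z → z + size n BT + size n BB)
           (trans (cong (_+ 1) (size-remove n BQ₁-a₁b a₁<b (s≤s b≤m)))
                  (size-remove n BQ-0c₁ 0<c₁ (<-trans c₁<m (n<1+n m)))) ⟩
    size n BQ + size n BT + size n BB ∎
    where
    open ≡-Reasoning
    open +-*-Solver using (solve; _:+_; con; _:=_)
    n : ℕ
    n = suc m
    BQ₁ BQ₂ : EdgeSet
    BQ₁ = remove BQ 0 c₁
    BQ₂ = remove BQ₁ a₁ b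
    BQ-0c₁ : BQ 0 c₁ ≡ true
    BQ-0c₁ = BQ⁺ (inj₁ (s≤s z≤n , <⇒≤ b<c₁ , n<1+n c₁))
    BQ₁-a₁b : BQ₁ a₁ b ≡ true
    BQ₁-a₁b = remove⁺ {BQ} {0} {c₁} {a₁} {b} (BQ⁺ (inj₁ (n<1+n a₁ , ≤-refl , <-trans b<c₁ (n<1+n c₁))))
      (λ (a₁≡0 , _) → <-irrefl (sym a₁≡0) 0<a₁)
    BQ₂⁻ : ∀ {x y} → BQ₂ x y ≡ true → InQ x y × ¬ (x ≡ 0 × y ≡ c₁) × ¬ (x ≡ a₁ × y ≡ b)
    BQ₂⁻ e = let (e₁ , not-a₁b) = remove⁻ {BQ₁} e ; (q , not-0c₁) = remove⁻ {BQ} e₁ in BQ⁻ q , not-0c₁ , not-a₁b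
    BQ₂∩BTB : ∀ x y → ¬ (BQ₂ x y ≡ true × (BT ∪ₑ BB) x y ≡ true)
    BQ₂∩BTB x y (q , tb) with BQ₂⁻ q | ∪ₑ⁻ {BT} {BB} tb
    ... | inQ , not-0c₁ , _ | inj₁ bt = let (tx , ty , _) = WT-diagonal⁻ (BT-diagonal bt) in InQ∩InT inQ tx ty not-0c₁
    ... | inQ , _ , not-a₁b | inj₂ bb = let (dx , dy , _) = WB-diagonal⁻ (BB-diagonal bb) in InQ∩InB inQ dx dy not-a₁b
    BT∩BB : ∀ x y → ¬ (BT x y ≡ true × BB x y ≡ true)
    BT∩BB x y (bt , bb) = InT∩InB (proj₁ (WT-diagonal⁻ (BT-diagonal bt))) (proj₁ (WB-diagonal⁻ (BB-diagonal bb)))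

proposition3p2 : (n a b c : ℕ) → 0 < a → a < b → b < c → c < n ∸ 1
    → 3 ≤ c ∸ b → 3 ≤ a → 2 ≤ n ∸ c → 2 ≤ b ∸ a
    → (BT BB : EdgeSet)
    → SaturatedBlocker (W-T n c) BT
    → SaturatedBlocker (W-B a b) BB
    → SaturatedBlocker (polygon n) (B-M n a b c BT BB)
      × size n (B-M n a b c BT BB) + 2
        ≡ (n ∸ c) * (b ∸ a) + (c ∸ b) * a + size n BT + size n BB
proposition3p2 zero _ _ _ _ _ _ () _ _ _ _ _ _ _ _
-- The hypothesis 2 ≤ n ∸ c is implied by c < n ∸ 1.
proposition3p2 (suc m) (suc a₁) (suc b₁) (suc c₁) _ a<b b<c c<m 3≤c-b 3≤a _ 2≤b-a BT BB satT satB =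
  BM-saturated , trans BM-size (cong (λ q → q + size (suc m) BT + size (suc m) BB) BQ-size)
  where
  open Construction m a₁ b₁ c₁ (≤-pred 3≤a) (m≤o∸n⇒m+n≤o 2 (<⇒≤ a<b) 2≤b-a)
    (≤-pred (m≤o∸n⇒m+n≤o 3 (<⇒≤ b<c) 3≤c-b)) c<m BT BB satT satB
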